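{- Let $s,t,n\in\mathbb{N}$ with $0\le t\le n-s$ and let $0<\varepsilon\le\frac1{100}$. If $\mathcal{A}\subseteq\binom{[n]}{s}$ satisfies $\mu_{s+t}(\partial^{t\cdot u}\mathcal{A})\le(1+\varepsilon)\mu_s(\mathcal{A})$, then there are a collection $\mathcal{M}\subseteq\mathcal{A}$ and collections $\mathcal{B}_{\mathcal{M}}\subseteq\binom{[n]}{s}$, $\mathcal{B}'_{\mathcal{M}}\subseteq\binom{[n]}{s+t}$ such that: (1) $|\mathcal{M}|\le 100\frac{\ln(1/\varepsilon)}{\binom{s+t}{t}}|\mathcal{A}|$; (2) $\mathcal{B}'_{\mathcal{M}}=\partial^{t\cdot u}\mathcal{M}$ and $\mu_{s+t}(\mathcal{B}'_{\mathcal{M}}\,\Delta\,\partial^{t\cdot u}\mathcal{A})\le6\varepsilon\,\mu_{s+t}(\partial^{t\cdot u}\mathcal{A})$; (3) $\mathcal{B}_{\mathcal{M}}=\{x\in\binom{[n]}{s}:\Pr_{y>x,|y|=s+t}[y\in\mathcal{B}'_{\mathcal{M}}]\ge\frac12\}$ (with $y$ uniform among vectors of weight $s+t$ above $x$) and $\mu_s(\mathcal{B}_{\mathcal{M}}\,\Delta\,\mathcal{A})\le18\varepsilon\,\mu_s(\mathcal{A})$.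
   Context: $\binom{[n]}{k}=\{x\in\{0,1\}^n:|x|=k\}$ and $\mu_k$ is the uniform measure on it; $\{0,1\}^n$ has the coordinatewise order. For $\mathcal{A}\subseteq\binom{[n]}{k}$, the upper shadow is $\partial^u\mathcal{A}=\{y\in\binom{[n]}{k+1}:\exists x\in\mathcal{A},x<y\}$, and $\partial^{t\cdot u}$ denotes $t$-fold application of $\partial^u$ (so $\partial^{t\cdot u}\mathcal{A}$ is the set of $y$ of weight $k+t$ lying above some element of $\mathcal{A}$). $\Delta$ is symmetric difference.
   Formalization: The parameter ε ranges only over the rationals with $0<\varepsilon\le\frac1{100}$. -}

module Defs where

open import Data.Bool.Base using (Bool; true; false; _∧_; _∨_; _xor_; not; if_then_else_)
open import Data.Nat.Base as ℕ using (ℕ; zero; suc; _≡ᵇ_)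
open import Data.Nat.Combinatorics using (_C_)
open import Data.Integer.Base using (+_)
open import Data.Rational.Base using (ℚ; 0ℚ; 1ℚ; _/_; _+_; _*_; _≤_)
open import Data.Vec.Base using (Vec; []; _∷_)
open import Data.List.Base as List using (List; []; _∷_; _++_; map; filter; length)
open import Data.Bool.ListAction using (any)
open import Relation.Nullary.Decidable using (does)
open import Data.Bool.Properties using (T?)

Cube : ℕ → Set
Cube n = Vec Bool n

allVecs : (n : ℕ) → List (Cube n)
allVecs zero    = [] ∷ []
allVecs (suc n) = map (false ∷_) (allVecs n) ++ map (true ∷_) (allVecs n)

weight : ∀ {n} → Cube n → ℕ
weight []          = 0
weight (false ∷ x) = weight x
weight (true ∷ x)  = suc (weight x)

leqᵇ : ∀ {n} → Cube n → Cube n → Bool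
leqᵇ []          []          = true
leqᵇ (true ∷ x)  (false ∷ y) = false
leqᵇ (_ ∷ x)     (_ ∷ y)     = leqᵇ x y

Family : ℕ → Set
Family n = Cube n → Bool

countSlice : ∀ {n} → ℕ → Family n → ℕ
countSlice {n} k F = length (filter (λ x → T? (F x ∧ (weight x ≡ᵇ k))) (allVecs n))

-- a / b as a rational; only ever used with b > 0 (then it is the
-- ordinary quotient), the value for b = 0 is an irrelevant default
ratio : ℕ → ℕ → ℚ
ratio a zero    = 0ℚ
ratio a (suc b) = (+ a) / suc b

μ : ∀ {n} → ℕ → Family n → ℚ
μ {n} k F = ratio (countSlice k F) (n C k)

InSlice : ∀ {n} → ℕ → Family n → Set
InSlice k F = ∀ x → F x ≡ true → weight x ≡ k
  where open import Relation.Binary.PropositionalEquality using (_≡_)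

_⊆F_ : ∀ {n} → Family n → Family n → Set
F ⊆F G = ∀ x → F x ≡ true → G x ≡ true
  where open import Relation.Binary.PropositionalEquality using (_≡_)

_Δ_ : ∀ {n} → Family n → Family n → Family n
(F Δ G) x = F x xor G x

upperShadow : ∀ {n} → ℕ → Family n → Family n
upperShadow {n} k F y =
  (weight y ≡ᵇ suc k) ∧ any (λ x → F x ∧ (weight x ≡ᵇ k) ∧ leqᵇ x y) (allVecs n)

iterShadow : ∀ {n} → ℕ → ℕ → Family n → Family n
iterShadow k zero    F = F
iterShadow k (suc t) F = upperShadow (k ℕ.+ t) (iterShadow k t F)

probAbove : ∀ {n} → ℕ → Family n → Cube n → ℚ
probAbove {n} m G x =
  ratio (length (filter (λ y → T? ((weight y ≡ᵇ m) ∧ leqᵇ x y ∧ G y)) (allVecs n)))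
        (length (filter (λ y → T? ((weight y ≡ᵇ m) ∧ leqᵇ x y)) (allVecs n)))

expTerm : ℕ → ℚ → ℚ
expTerm zero    x = 1ℚ
expTerm (suc j) x = expTerm j x * (x * ((+ 1) / suc j))

expPartial : ℕ → ℚ → ℚ
expPartial zero    x = 1ℚ
expPartial (suc N) x = expPartial N x + expTerm (suc N) x

-- For naturals a, b and a rational y > 0:
--   LeMulLn a b y  means   a ≤ b · ln y   (as real numbers).
-- If b = 0 this says a = 0; if b > 0 it says a/b ≤ ln y, i.e.
-- exp(a/b) ≤ y, i.e. (as a/b ≥ 0) every partial sum of the exponential
-- series at a/b is ≤ y.
LeMulLn : ℕ → ℕ → ℚ → Set
LeMulLn a zero    y = a ≡ 0
  where open import Relation.Binary.PropositionalEquality using (_≡_)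
LeMulLn a (suc b) y = ∀ N → expPartial N (ratio a (suc b)) ≤ y

module Submission where

-- Count the pairs x ≤ y with |x| = s and y ∈ ∂A: each y lies above d↓ = C(s+t,t) points of weight s and
-- each x ∈ A below d↑ points of weight s+t, so β·d↓ = α·d↑ + excess, and the hypothesis makes the excess
-- at most ε·α·d↑. Hence only O(ε)β points of ∂A are bad, i.e. have fewer than half of their lower s-points
-- in A. The good points are covered greedily: adding the point of A above which most uncovered good
-- points lie removes, by averaging, a d↓/2α fraction of them, so about (2α/d↓)·log₂(1/ε) points of A
-- leave at most 2εβ good points uncovered; this M satisfies (1), and ∂M misses only bad or uncovered points
-- of ∂A, giving (2). Majority decoding of ∂M then recovers A, each error being charged to the excess or to
-- ∂A ∖ ∂M by the same double counting, which gives (3).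

module Combinatorics where

  open import Defs
  open import Data.Bool.Base using (Bool; true; false; _∧_; _∨_; not; T)
  open import Data.Bool.Properties using (T?; ∧-zeroʳ; ∧-identityʳ; ∨-assoc; ∨-zeroʳ)
  import Data.Bool.Properties as Boolᵖ
  open import Data.Bool.ListAction using (any)
  open import Data.Nat.Base using (ℕ; zero; suc; _≡ᵇ_; _+_; _*_; _≤_; _<_; z≤n; s≤s; _∸_; _≤ᵇ_; _^_; NonZero; >-nonZero)
  open import Data.Nat.Properties
  open import Data.Nat.Combinatorics using (_C_; nCk+nC[k+1]≡[n+1]C[k+1]; nCk≡nC[n∸k])
  open import Data.List.Base using (List; []; _∷_; _++_; map; filter; length)
  open import Data.Vec.Base using ([]; _∷_)
  open import Data.Vec.Properties using (≡-dec)
  open import Data.Product using (∃; _×_; _,_; proj₁; proj₂)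
  open import Data.Sum using (_⊎_; inj₁; inj₂)
  open import Data.Empty using (⊥; ⊥-elim)
  open import Function using (_∘_)
  open import Relation.Binary.PropositionalEquality
  open import Relation.Nullary using (Dec; yes; no; does)
  open import Data.Nat.DivMod using (_/_; m≡m%n+[m/n]*n; m%n<n; m/n*n≤m)
  open import Data.Nat.Solver using (module +-*-Solver)
  open +-*-Solver using (solve; _:+_; _:*_; _:=_; con)
  open import Algebra.Properties.CommutativeSemigroup +-commutativeSemigroup using () renaming (interchange to +-interchange)

  ∧-true⇒ˡ : ∀ a {b} → (a ∧ b) ≡ true → a ≡ true
  ∧-true⇒ˡ true e = refl

  ∧-true⇒ʳ : ∀ a {b} → (a ∧ b) ≡ true → b ≡ true
  ∧-true⇒ʳ true e = e

  ∧-true : ∀ {a b} → a ≡ true → b ≡ true → (a ∧ b) ≡ true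
  ∧-true refl refl = refl

  ≡ᵇ-true⇒≡ : ∀ {m n} → (m ≡ᵇ n) ≡ true → m ≡ n
  ≡ᵇ-true⇒≡ {m} {n} e = ≡ᵇ⇒≡ m n (subst T (sym e) _)

  ≡⇒≡ᵇ-true : ∀ {m n} → m ≡ n → (m ≡ᵇ n) ≡ true
  ≡⇒≡ᵇ-true {m} {n} e with m ≡ᵇ n | ≡⇒≡ᵇ m n e
  ... | true | _ = refl

  ≤ᵇ-true⇒≤ : ∀ {m n} → (m ≤ᵇ n) ≡ true → m ≤ n
  ≤ᵇ-true⇒≤ {m} {n} e = ≤ᵇ⇒≤ m n (subst T (sym e) _)

  ≤⇒≤ᵇ-true : ∀ {m n} → m ≤ n → (m ≤ᵇ n) ≡ true
  ≤⇒≤ᵇ-true {m} {n} m≤n with m ≤ᵇ n | ≤⇒≤ᵇ m≤n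
  ... | true | _ = refl

  ≤ᵇ-false⇒> : ∀ {m n} → (m ≤ᵇ n) ≡ false → n < m
  ≤ᵇ-false⇒> {m} {n} e = ≰⇒> λ m≤n → absurd (trans (sym (T⇒true (≤⇒≤ᵇ m≤n))) e)
    where
    T⇒true : ∀ {b} → T b → b ≡ true
    T⇒true {true} _ = refl
    absurd : true ≡ false → ⊥
    absurd ()

  ≡true-ext : ∀ {a b} → (a ≡ true → b ≡ true) → (b ≡ true → a ≡ true) → a ≡ b
  ≡true-ext {false} {false} f g = refl
  ≡true-ext {false} {true}  f g = g refl
  ≡true-ext {true}  {false} f g = sym (f refl)
  ≡true-ext {true}  {true}  f g = refl

  𝟙 : Bool → ℕ
  𝟙 true  = 1
  𝟙 false = 0

  𝟙≤1 : ∀ b → 𝟙 b ≤ 1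
  𝟙≤1 false = z≤n
  𝟙≤1 true  = s≤s z≤n

  𝟙-positive : ∀ {b} → 1 ≤ 𝟙 b → b ≡ true
  𝟙-positive {true} _ = refl

  𝟙-∨ : ∀ a b → 𝟙 (a ∨ b) ≤ 𝟙 a + 𝟙 b
  𝟙-∨ false b = ≤-refl
  𝟙-∨ true  b = s≤s z≤n

  𝟙-exchange : ∀ a b c → 𝟙 a * 𝟙 (b ∧ c) ≡ 𝟙 b * 𝟙 (a ∧ c)
  𝟙-exchange false false c = refl
  𝟙-exchange false true  c = sym (+-identityʳ _)
  𝟙-exchange true  false c = refl
  𝟙-exchange true  true  c = trans (+-identityʳ _) (sym (+-identityʳ _))

  ∑ : {A : Set} → List A → (A → ℕ) → ℕ
  ∑ []       f = 0
  ∑ (x ∷ xs) f = f x + ∑ xs f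

  private
    variable
      A B : Set

  ∑-++ : ∀ (xs ys : List A) f → ∑ (xs ++ ys) f ≡ ∑ xs f + ∑ ys f
  ∑-++ []       ys f = refl
  ∑-++ (x ∷ xs) ys f = trans (cong (f x +_) (∑-++ xs ys f)) (sym (+-assoc (f x) _ _))

  ∑-cong : ∀ (xs : List A) {f g} → (∀ x → f x ≡ g x) → ∑ xs f ≡ ∑ xs g
  ∑-cong []       e = refl
  ∑-cong (x ∷ xs) e = cong₂ _+_ (e x) (∑-cong xs e)

  ∑-mono-≤ : ∀ (xs : List A) {f g} → (∀ x → f x ≤ g x) → ∑ xs f ≤ ∑ xs g
  ∑-mono-≤ []       e = z≤n
  ∑-mono-≤ (x ∷ xs) e = +-mono-≤ (e x) (∑-mono-≤ xs e)

  ∑-+ : ∀ (xs : List A) f g → ∑ xs (λ x → f x + g x) ≡ ∑ xs f + ∑ xs g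
  ∑-+ []       f g = refl
  ∑-+ (x ∷ xs) f g = trans (cong (f x + g x +_) (∑-+ xs f g)) (+-interchange (f x) (g x) _ _)

  ∑-*ˡ : ∀ (xs : List A) m f → ∑ xs (λ x → m * f x) ≡ m * ∑ xs f
  ∑-*ˡ []       m f = sym (*-zeroʳ m)
  ∑-*ˡ (x ∷ xs) m f = trans (cong (m * f x +_) (∑-*ˡ xs m f)) (sym (*-distribˡ-+ m (f x) _))

  ∑-zero : ∀ (xs : List A) {f} → (∀ x → f x ≡ 0) → ∑ xs f ≡ 0
  ∑-zero []       e = refl
  ∑-zero (x ∷ xs) e = cong₂ _+_ (e x) (∑-zero xs e)

  ∑-swap : ∀ (xs : List A) (ys : List B) (h : A → B → ℕ) →
    ∑ xs (λ x → ∑ ys (h x)) ≡ ∑ ys (λ y → ∑ xs (λ x → h x y))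
  ∑-swap []       ys h = sym (∑-zero ys (λ _ → refl))
  ∑-swap (x ∷ xs) ys h = trans (cong (∑ ys (h x) +_) (∑-swap xs ys h)) (sym (∑-+ ys (h x) (λ y → ∑ xs (λ x → h x y))))

  length-filter≡∑𝟙 : ∀ (xs : List A) (P : A → Bool) → length (filter (T? ∘ P) xs) ≡ ∑ xs (𝟙 ∘ P)
  length-filter≡∑𝟙 []       P = refl
  length-filter≡∑𝟙 (x ∷ xs) P with P x
  ... | true  = cong suc (length-filter≡∑𝟙 xs P)
  ... | false = length-filter≡∑𝟙 xs P

  ∑-positive : ∀ (xs : List A) f → 1 ≤ ∑ xs f → ∃ λ x → 1 ≤ f x
  ∑-positive (x ∷ xs) f h with f x in fx
  ... | zero  = ∑-positive xs f h
  ... | suc _ = x , subst (1 ≤_) (sym fx) (s≤s z≤n)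

  ∑-averaging : ∀ (P : A → Bool) (g : A → ℕ) (xs : List A) →
    ∑ xs (λ x → 𝟙 (P x) * g x) ≡ 0 ⊎
    ∃ λ z → P z ≡ true × ∑ xs (λ x → 𝟙 (P x) * g x) ≤ ∑ xs (λ x → 𝟙 (P x)) * g z
  ∑-averaging P g [] = inj₁ refl
  ∑-averaging P g (y ∷ xs) with P y in Py | ∑-averaging P g xs
  ... | false | rest = rest
  ... | true | inj₁ z = inj₂ (y , Py , +-mono-≤ (≤-reflexive (+-identityʳ (g y))) (≤-trans (≤-reflexive z) z≤n))
  ... | true | inj₂ (x , Px , le) with g x ≤? g y
  ...   | yes gx≤gy = inj₂ (y , Py , +-mono-≤ (≤-reflexive (+-identityʳ (g y))) (≤-trans le (*-monoʳ-≤ (∑ xs (λ x → 𝟙 (P x))) gx≤gy)))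
  ...   | no gx≰gy  = inj₂ (x , Px , +-mono-≤ (≤-trans (≤-reflexive (+-identityʳ (g y))) (<⇒≤ (≰⇒> gx≰gy))) le)

  ∑ᶜ : ∀ {n} → (Cube n → ℕ) → ℕ
  ∑ᶜ {n} = ∑ (allVecs n)

  infix 6.5 ∑ᶜ
  syntax ∑ᶜ (λ x → e) = ∑[ x ] e

  ∑ᶜ-∷ : ∀ {n} (f : Cube (suc n) → ℕ) → ∑[ x ] f x ≡ ∑[ x ] f (false ∷ x) + ∑[ x ] f (true ∷ x)
  ∑ᶜ-∷ {n} f = trans (∑-++ (map (false ∷_) (allVecs n)) _ f) (cong₂ _+_ (∑-map (allVecs n)) (∑-map (allVecs n)))
    where
    ∑-map : ∀ {b} xs → ∑ (map (b ∷_) xs) f ≡ ∑ xs (λ x → f (b ∷ x))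
    ∑-map []       = refl
    ∑-map (x ∷ xs) = cong (f _ +_) (∑-map xs)

  ∑ᶜ-*ʳ : ∀ {n} (f : Cube n → ℕ) m → ∑[ x ] f x * m ≡ (∑[ x ] f x) * m
  ∑ᶜ-*ʳ {n} f m = trans (∑-cong (allVecs n) (λ x → *-comm (f x) m)) (trans (∑-*ˡ (allVecs n) m f) (*-comm m _))

  #_ : ∀ {n} → Family n → ℕ
  # F = ∑[ x ] 𝟙 (F x)

  _∩_ _∪_ _∖_ : ∀ {n} → Family n → Family n → Family n
  (F ∩ G) x = F x ∧ G x
  (F ∪ G) x = F x ∨ G x
  (F ∖ G) x = F x ∧ not (G x)

  _≟ᶜ_ : ∀ {n} (x y : Cube n) → Dec (x ≡ y)
  _≟ᶜ_ = ≡-dec Boolᵖ._≟_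

  ∅ : ∀ {n} → Family n
  ∅ _ = false

  ｛_｝ : ∀ {n} → Cube n → Family n
  ｛ x ｝ z = does (z ≟ᶜ x)

  #｛｝ : ∀ {n} (x : Cube n) → # ｛ x ｝ ≡ 1
  #｛｝ []          = refl
  #｛｝ {suc n} (false ∷ x) = trans (∑ᶜ-∷ (𝟙 ∘ ｛ false ∷ x ｝)) (cong₂ _+_ (#｛｝ x) (∑-zero (allVecs n) (λ _ → refl)))
  #｛｝ {suc n} (true ∷ x)  = trans (∑ᶜ-∷ (𝟙 ∘ ｛ true ∷ x ｝)) (cong₂ _+_ (∑-zero (allVecs n) (λ _ → refl)) (#｛｝ x))

  ∈｛｝⇒≡ : ∀ {n} {x z : Cube n} → ｛ x ｝ z ≡ true → z ≡ x
  ∈｛｝⇒≡ {x = x} {z} e with z ≟ᶜ x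
  ... | yes z≡x = z≡x

  x∈｛x｝ : ∀ {n} (x : Cube n) → ｛ x ｝ x ≡ true
  x∈｛x｝ x with x ≟ᶜ x
  ... | yes _   = refl
  ... | no  x≢x = ⊥-elim (x≢x refl)

  #-∪ : ∀ {n} (F G : Family n) → # (F ∪ G) ≤ # F + # G
  #-∪ {n} F G = ≤-trans (∑-mono-≤ (allVecs n) (λ x → 𝟙-∨ (F x) (G x))) (≤-reflexive (∑-+ (allVecs n) (𝟙 ∘ F) (𝟙 ∘ G)))

  slice : ∀ {n} → ℕ → Family n
  slice k x = weight x ≡ᵇ k

  countSlice≡# : ∀ {n} k (F : Family n) → countSlice k F ≡ # (F ∩ slice k)
  countSlice≡# {n} k F = length-filter≡∑𝟙 (allVecs n) (F ∩ slice k)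

  countSlice-InSlice : ∀ {n} k (F : Family n) → InSlice k F → countSlice k F ≡ # F
  countSlice-InSlice {n} k F F⊆k = trans (countSlice≡# k F) (∑-cong (allVecs n) 𝟙-∩)
    where
    𝟙-∩ : ∀ x → 𝟙 (F x ∧ slice k x) ≡ 𝟙 (F x)
    𝟙-∩ x with F x in Fx
    ... | false = refl
    ... | true  = cong 𝟙 (≡⇒≡ᵇ-true (F⊆k x Fx))

  #-mono : ∀ {n} {F G : Family n} → F ⊆F G → # F ≤ # G
  #-mono {n} {F} {G} F⊆G = ∑-mono-≤ (allVecs n) 𝟙-mono
    where
    𝟙-mono : ∀ x → 𝟙 (F x) ≤ 𝟙 (G x)
    𝟙-mono x with F x in Fx
    ... | false = z≤n
    ... | true  rewrite F⊆G x Fx = ≤-refl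

  ones zeros : ∀ n → Cube n
  ones  zero    = []
  ones  (suc n) = true ∷ ones n
  zeros zero    = []
  zeros (suc n) = false ∷ zeros n

  weight-ones : ∀ n → weight (ones n) ≡ n
  weight-ones zero    = refl
  weight-ones (suc n) = cong suc (weight-ones n)

  weight-zeros : ∀ n → weight (zeros n) ≡ 0
  weight-zeros zero    = refl
  weight-zeros (suc n) = weight-zeros n

  leqᵇ-ones : ∀ {n} (x : Cube n) → leqᵇ x (ones n) ≡ true
  leqᵇ-ones []          = refl
  leqᵇ-ones (false ∷ x) = leqᵇ-ones x
  leqᵇ-ones (true ∷ x)  = leqᵇ-ones x

  zeros-leqᵇ : ∀ {n} (x : Cube n) → leqᵇ (zeros n) x ≡ true
  zeros-leqᵇ []          = refl
  zeros-leqᵇ (false ∷ x) = zeros-leqᵇ x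
  zeros-leqᵇ (true ∷ x)  = zeros-leqᵇ x

  leqᵇ-refl : ∀ {n} (x : Cube n) → leqᵇ x x ≡ true
  leqᵇ-refl []          = refl
  leqᵇ-refl (false ∷ x) = leqᵇ-refl x
  leqᵇ-refl (true ∷ x)  = leqᵇ-refl x

  leqᵇ-trans : ∀ {n} (x y z : Cube n) → leqᵇ x y ≡ true → leqᵇ y z ≡ true → leqᵇ x z ≡ true
  leqᵇ-trans []          []          []          p q = refl
  leqᵇ-trans (false ∷ x) (false ∷ y) (false ∷ z) p q = leqᵇ-trans x y z p q
  leqᵇ-trans (false ∷ x) (false ∷ y) (true ∷ z)  p q = leqᵇ-trans x y z p q
  leqᵇ-trans (false ∷ x) (true ∷ y)  (true ∷ z)  p q = leqᵇ-trans x y z p q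
  leqᵇ-trans (true ∷ x)  (true ∷ y)  (true ∷ z)  p q = leqᵇ-trans x y z p q
  leqᵇ-trans (false ∷ x) (true ∷ y)  (false ∷ z) p ()
  leqᵇ-trans (true ∷ x)  (true ∷ y)  (false ∷ z) p ()
  leqᵇ-trans (true ∷ x)  (false ∷ y) z           () q

  weight-mono : ∀ {n} (x y : Cube n) → leqᵇ x y ≡ true → weight x ≤ weight y
  weight-mono []          []          p = z≤n
  weight-mono (false ∷ x) (false ∷ y) p = weight-mono x y p
  weight-mono (false ∷ x) (true ∷ y)  p = m≤n⇒m≤1+n (weight-mono x y p)
  weight-mono (true ∷ x)  (true ∷ y)  p = s≤s (weight-mono x y p)
  weight-mono (true ∷ x)  (false ∷ y) ()

  leqᵇ∧weight≡⇒≡ : ∀ {n} (x y : Cube n) → leqᵇ x y ≡ true → weight x ≡ weight y → x ≡ y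
  leqᵇ∧weight≡⇒≡ []          []          p e = refl
  leqᵇ∧weight≡⇒≡ (false ∷ x) (false ∷ y) p e = cong (false ∷_) (leqᵇ∧weight≡⇒≡ x y p e)
  leqᵇ∧weight≡⇒≡ (true ∷ x)  (true ∷ y)  p e = cong (true ∷_) (leqᵇ∧weight≡⇒≡ x y p (suc-injective e))
  leqᵇ∧weight≡⇒≡ (false ∷ x) (true ∷ y)  p e = ⊥-elim (<⇒≱ (s≤s (weight-mono x y p)) (≤-reflexive (sym e)))
  leqᵇ∧weight≡⇒≡ (true ∷ x)  (false ∷ y) () e

  covering-step : ∀ {n} (x y : Cube n) → leqᵇ x y ≡ true → weight x < weight y →
    ∃ λ z → leqᵇ x z ≡ true × leqᵇ z y ≡ true × suc (weight z) ≡ weight y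
  covering-step (false ∷ x) (false ∷ y) p lt with covering-step x y p lt
  ... | z , x≤z , z≤y , wz = false ∷ z , x≤z , z≤y , wz
  covering-step (false ∷ x) (true ∷ y)  p lt = false ∷ y , p , leqᵇ-refl y , refl
  covering-step (true ∷ x)  (true ∷ y)  p (s≤s lt) with covering-step x y p lt
  ... | z , x≤z , z≤y , wz = true ∷ z , x≤z , z≤y , cong suc wz
  covering-step (true ∷ x)  (false ∷ y) () lt

  any⇒∃ : ∀ {A : Set} (P : A → Bool) xs → any P xs ≡ true → ∃ λ x → P x ≡ true
  any⇒∃ P (x ∷ xs) e with P x in Px
  ... | true  = x , Px
  ... | false = any⇒∃ P xs e

  any-++ : ∀ {A : Set} (P : A → Bool) xs ys → any P (xs ++ ys) ≡ (any P xs ∨ any P ys)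
  any-++ P []       ys = refl
  any-++ P (x ∷ xs) ys rewrite any-++ P xs ys = sym (∨-assoc (P x) _ _)

  any-map : ∀ {A B : Set} (P : B → Bool) (f : A → B) xs → any P (map f xs) ≡ any (P ∘ f) xs
  any-map P f []       = refl
  any-map P f (x ∷ xs) = cong (P (f x) ∨_) (any-map P f xs)

  ∃⇒any-allVecs : ∀ {n} (P : Cube n → Bool) x → P x ≡ true → any P (allVecs n) ≡ true
  ∃⇒any-allVecs P [] e = cong (_∨ false) e
  ∃⇒any-allVecs {suc n} P (false ∷ x) e
    rewrite any-++ P (map (false ∷_) (allVecs n)) (map (true ∷_) (allVecs n))
          | any-map P (false ∷_) (allVecs n) | ∃⇒any-allVecs (λ y → P (false ∷ y)) x e = refl
  ∃⇒any-allVecs {suc n} P (true ∷ x) e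
    rewrite any-++ P (map (false ∷_) (allVecs n)) (map (true ∷_) (allVecs n))
          | any-map P (true ∷_) (allVecs n) | ∃⇒any-allVecs (λ y → P (true ∷ y)) x e = ∨-zeroʳ _

  below above : ∀ {n} → Family n → Cube n → ℕ
  below F y = ∑[ x ] 𝟙 (F x ∧ leqᵇ x y)
  above G x = ∑[ y ] 𝟙 (G y ∧ leqᵇ x y)

  ∑-above≡∑-below : ∀ {n} (F G : Family n) → ∑[ x ] 𝟙 (F x) * above G x ≡ ∑[ y ] 𝟙 (G y) * below F y
  ∑-above≡∑-below {n} F G = begin
    ∑[ x ] 𝟙 (F x) * above G x
      ≡⟨ ∑-cong (allVecs n) (λ x → ∑-*ˡ (allVecs n) (𝟙 (F x)) _) ⟨
    ∑[ x ] ∑[ y ] 𝟙 (F x) * 𝟙 (G y ∧ leqᵇ x y)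
      ≡⟨ ∑-swap (allVecs n) (allVecs n) (λ x y → 𝟙 (F x) * 𝟙 (G y ∧ leqᵇ x y)) ⟩
    ∑[ y ] ∑[ x ] 𝟙 (F x) * 𝟙 (G y ∧ leqᵇ x y)
      ≡⟨ ∑-cong (allVecs n) (λ y → ∑-cong (allVecs n) (λ x → 𝟙-exchange (F x) (G y) (leqᵇ x y))) ⟩
    ∑[ y ] ∑[ x ] 𝟙 (G y) * 𝟙 (F x ∧ leqᵇ x y)
      ≡⟨ ∑-cong (allVecs n) (λ y → ∑-*ˡ (allVecs n) (𝟙 (G y)) _) ⟩
    ∑[ y ] 𝟙 (G y) * below F y ∎
    where open ≡-Reasoning

  interval : ∀ {n} → Cube n → Cube n → ℕ → Family n
  interval x z j y = (weight y ≡ᵇ weight x + j) ∧ (leqᵇ x y ∧ leqᵇ y z)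

  #interval : ∀ {n} (x z : Cube n) j → leqᵇ x z ≡ true → # (interval x z j) ≡ (weight z ∸ weight x) C j
  #interval [] [] zero    p = refl
  #interval [] [] (suc j) p = refl
  #interval {suc n} (false ∷ x) (false ∷ z) j p = begin
    # (interval (false ∷ x) (false ∷ z) j)           ≡⟨ ∑ᶜ-∷ (𝟙 ∘ interval (false ∷ x) (false ∷ z) j) ⟩
    # (interval x z j) + ∑[ y ] 𝟙 ((suc (weight y) ≡ᵇ weight x + j) ∧ (leqᵇ x y ∧ false))
      ≡⟨ cong₂ _+_ (#interval x z j p) (∑-zero (allVecs n) (λ y → cong 𝟙 (trans (cong ((suc (weight y) ≡ᵇ weight x + j) ∧_) (∧-zeroʳ (leqᵇ x y))) (∧-zeroʳ _)))) ⟩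
    (weight z ∸ weight x) C j + 0                      ≡⟨ +-identityʳ _ ⟩
    (weight z ∸ weight x) C j ∎
    where open ≡-Reasoning
  #interval {suc n} (true ∷ x) (true ∷ z) j p =
    trans (∑ᶜ-∷ (𝟙 ∘ interval (true ∷ x) (true ∷ z) j)) (cong₂ _+_ (∑-zero (allVecs n) (λ y → cong 𝟙 (∧-zeroʳ _))) (#interval x z j p))
  #interval {suc n} (false ∷ x) (true ∷ z) zero p =
    trans (∑ᶜ-∷ (𝟙 ∘ interval (false ∷ x) (true ∷ z) zero)) (cong₂ _+_ (#interval x z zero p) (∑-zero (allVecs n) too-heavy))
    where
    too-heavy : ∀ y → 𝟙 ((suc (weight y) ≡ᵇ weight x + 0) ∧ (leqᵇ x y ∧ leqᵇ y z)) ≡ 0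
    too-heavy y with leqᵇ x y in x≤y | suc (weight y) ≡ᵇ weight x + 0 in e
    ... | false | _     = cong 𝟙 (∧-zeroʳ _)
    ... | true  | false = refl
    ... | true  | true  = ⊥-elim (<⇒≱ (s≤s (weight-mono x y x≤y)) (≤-reflexive (trans (≡ᵇ-true⇒≡ e) (+-identityʳ _))))
  #interval {suc n} (false ∷ x) (true ∷ z) (suc j) p = begin
    # (interval (false ∷ x) (true ∷ z) (suc j))        ≡⟨ ∑ᶜ-∷ (𝟙 ∘ interval (false ∷ x) (true ∷ z) (suc j)) ⟩
    # (interval x z (suc j)) + ∑[ y ] 𝟙 ((suc (weight y) ≡ᵇ weight x + suc j) ∧ (leqᵇ x y ∧ leqᵇ y z))
      ≡⟨ cong (# (interval x z (suc j)) +_) (∑-cong (allVecs n) (λ y → cong (λ k → 𝟙 ((suc (weight y) ≡ᵇ k) ∧ (leqᵇ x y ∧ leqᵇ y z))) (+-suc (weight x) j))) ⟩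
    # (interval x z (suc j)) + # (interval x z j)     ≡⟨ cong₂ _+_ (#interval x z (suc j) p) (#interval x z j p) ⟩
    m C suc j + m C j                                  ≡⟨ +-comm (m C suc j) _ ⟩
    m C j + m C suc j                                  ≡⟨ nCk+nC[k+1]≡[n+1]C[k+1] m j ⟩
    suc m C suc j                                      ≡⟨ cong (_C suc j) (+-∸-assoc 1 (weight-mono x z p)) ⟨
    (suc (weight z) ∸ weight x) C suc j ∎
    where
    open ≡-Reasoning
    m = weight z ∸ weight x
  #interval (true ∷ x) (false ∷ z) j ()

  below-slice : ∀ {n} (y : Cube n) k → below (slice k) y ≡ weight y C k
  below-slice {n} y k = begin
    below (slice k) y
      ≡⟨ ∑-cong (allVecs n) (λ x → cong₂ (λ w b → 𝟙 ((weight x ≡ᵇ w) ∧ b)) (cong (_+ k) (sym (weight-zeros n))) (cong (_∧ leqᵇ x y) (sym (zeros-leqᵇ x)))) ⟩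
    # (interval (zeros n) y k)             ≡⟨ #interval (zeros n) y k (zeros-leqᵇ y) ⟩
    (weight y ∸ weight (zeros n)) C k      ≡⟨ cong (λ w → (weight y ∸ w) C k) (weight-zeros n) ⟩
    weight y C k ∎
    where open ≡-Reasoning

  above-slice : ∀ {n} (x : Cube n) s t → weight x ≡ s → above (slice (s + t)) x ≡ (n ∸ s) C t
  above-slice {n} x s t refl = begin
    above (slice (s + t)) x
      ≡⟨ ∑-cong (allVecs n) (λ y → cong (λ b → 𝟙 ((weight y ≡ᵇ weight x + t) ∧ b)) (trans (sym (∧-identityʳ _)) (cong (leqᵇ x y ∧_) (sym (leqᵇ-ones y))))) ⟩
    # (interval x (ones n) t)               ≡⟨ #interval x (ones n) t (leqᵇ-ones x) ⟩
    (weight (ones n) ∸ s) C t               ≡⟨ cong (λ w → (w ∸ s) C t) (weight-ones n) ⟩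
    (n ∸ s) C t ∎
    where open ≡-Reasoning

  #slice : ∀ n k → # (slice {n} k) ≡ n C k
  #slice n k = begin
    # (slice {n} k)
      ≡⟨ ∑-cong (allVecs n) (λ x → cong 𝟙 (trans (sym (∧-identityʳ _)) (cong ((weight x ≡ᵇ k) ∧_) (sym (leqᵇ-ones x))))) ⟩
    below (slice k) (ones n)             ≡⟨ below-slice (ones n) k ⟩
    weight (ones n) C k                  ≡⟨ cong (_C k) (weight-ones n) ⟩
    n C k ∎
    where open ≡-Reasoning

  C-positive : ∀ m k → k ≤ m → 1 ≤ m C k
  C-positive m       zero    _         = s≤s z≤n
  C-positive (suc m) (suc k) (s≤s k≤m) =
    ≤-trans (C-positive m k k≤m) (≤-trans (m≤m+n _ _) (≤-reflexive (nCk+nC[k+1]≡[n+1]C[k+1] m k)))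

  C-sym : ∀ a b → (a + b) C a ≡ (a + b) C b
  C-sym a b = trans (nCk≡nC[n∸k] (m≤m+n a b)) (cong ((a + b) C_) (m+n∸m≡n a b))

  covers : ∀ {n} → Family n → Cube n → Bool
  covers {n} F y = any (λ x → F x ∧ leqᵇ x y) (allVecs n)

  covers-mono : ∀ {n} {F G : Family n} → F ⊆F G → ∀ y → covers F y ≡ true → covers G y ≡ true
  covers-mono {n} {F} {G} F⊆G y e with any⇒∃ (λ x → F x ∧ leqᵇ x y) (allVecs n) e
  ... | x , Fx∧x≤y = ∃⇒any-allVecs (λ x → G x ∧ leqᵇ x y) x (∧-true (F⊆G x (∧-true⇒ˡ (F x) Fx∧x≤y)) (∧-true⇒ʳ (F x) Fx∧x≤y))

  covers-∪｛｝ : ∀ {n} (F : Family n) x y → covers (F ∪ ｛ x ｝) y ≡ (covers F y ∨ leqᵇ x y)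
  covers-∪｛｝ {n} F x y = ≡true-ext to from
    where
    to : covers (F ∪ ｛ x ｝) y ≡ true → (covers F y ∨ leqᵇ x y) ≡ true
    to e with any⇒∃ (λ z → (F ∪ ｛ x ｝) z ∧ leqᵇ z y) (allVecs n) e
    ... | z , hz with F z in Fz
    ... | true  = cong (_∨ leqᵇ x y) (∃⇒any-allVecs (λ z → F z ∧ leqᵇ z y) z (∧-true Fz hz))
    ... | false = trans (cong (covers F y ∨_) (subst (λ w → leqᵇ w y ≡ true) (∈｛｝⇒≡ {x = x} {z} (∧-true⇒ˡ (｛ x ｝ z) hz)) (∧-true⇒ʳ (｛ x ｝ z) hz))) (∨-zeroʳ _)
    from : (covers F y ∨ leqᵇ x y) ≡ true → covers (F ∪ ｛ x ｝) y ≡ true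
    from e with covers F y in cF
    ... | true with any⇒∃ (λ z → F z ∧ leqᵇ z y) (allVecs n) cF
    ...   | z , hz = ∃⇒any-allVecs (λ z → (F ∪ ｛ x ｝) z ∧ leqᵇ z y) z (∧-true (cong (_∨ ｛ x ｝ z) (∧-true⇒ˡ (F z) hz)) (∧-true⇒ʳ (F z) hz))
    from e | false = ∃⇒any-allVecs (λ z → (F ∪ ｛ x ｝) z ∧ leqᵇ z y) x (∧-true (trans (cong (F x ∨_) (x∈｛x｝ x)) (∨-zeroʳ _)) e)

  covers-∅ : ∀ {n} (y : Cube n) → covers ∅ y ≡ false
  covers-∅ {n} y = any-false (allVecs n)
    where
    any-false : ∀ (xs : List (Cube n)) → any (λ x → ∅ x ∧ leqᵇ x y) xs ≡ false
    any-false []       = refl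
    any-false (_ ∷ xs) = any-false xs

  uncovered⇒below≡0 : ∀ {n} (F : Family n) y → covers F y ≡ false → below F y ≡ 0
  uncovered⇒below≡0 {n} F y uncovered = ∑-zero (allVecs n) 𝟙≡0
    where
    𝟙≡0 : ∀ x → 𝟙 (F x ∧ leqᵇ x y) ≡ 0
    𝟙≡0 x with F x ∧ leqᵇ x y in e
    ... | false = refl
    ... | true  with trans (sym (∃⇒any-allVecs (λ x → F x ∧ leqᵇ x y) x e)) uncovered
    ... | ()

  iterShadow≡covers : ∀ {n} s t (F : Family n) → InSlice s F → ∀ y →
    iterShadow s t F y ≡ (slice (s + t) y ∧ covers F y)
  iterShadow≡covers {n} s zero F F⊆s y = ≡true-ext to from
    where
    to : F y ≡ true → (slice (s + 0) y ∧ covers F y) ≡ true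
    to Fy = ∧-true (≡⇒≡ᵇ-true (trans (F⊆s y Fy) (sym (+-identityʳ s))))
                   (∃⇒any-allVecs (λ x → F x ∧ leqᵇ x y) y (∧-true Fy (leqᵇ-refl y)))
    from : (slice (s + 0) y ∧ covers F y) ≡ true → F y ≡ true
    from e with any⇒∃ (λ x → F x ∧ leqᵇ x y) (allVecs n) (∧-true⇒ʳ (slice (s + 0) y) e)
    ... | x , Fx∧x≤y = subst (λ z → F z ≡ true) x≡y (∧-true⇒ˡ (F x) Fx∧x≤y)
      where
      x≡y : x ≡ y
      x≡y = leqᵇ∧weight≡⇒≡ x y (∧-true⇒ʳ (F x) Fx∧x≤y)
              (trans (F⊆s x (∧-true⇒ˡ (F x) Fx∧x≤y)) (sym (trans (≡ᵇ-true⇒≡ (∧-true⇒ˡ _ e)) (+-identityʳ s))))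
  iterShadow≡covers {n} s (suc t) F F⊆s y = ≡true-ext to from
    where
    G = iterShadow s t F
    G≡ = iterShadow≡covers s t F F⊆s
    to : iterShadow s (suc t) F y ≡ true → (slice (s + suc t) y ∧ covers F y) ≡ true
    to e with any⇒∃ (λ z → G z ∧ (weight z ≡ᵇ s + t) ∧ leqᵇ z y) (allVecs n) (∧-true⇒ʳ (weight y ≡ᵇ suc (s + t)) e)
    ... | z , hz with any⇒∃ (λ x → F x ∧ leqᵇ x z) (allVecs n) (∧-true⇒ʳ (slice (s + t) z) (trans (sym (G≡ z)) (∧-true⇒ˡ (G z) hz)))
    ... | x , Fx∧x≤z =
      ∧-true (≡⇒≡ᵇ-true {weight y} (trans (≡ᵇ-true⇒≡ (∧-true⇒ˡ (weight y ≡ᵇ suc (s + t)) e)) (sym (+-suc s t))))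
             (∃⇒any-allVecs (λ x → F x ∧ leqᵇ x y) x
               (∧-true (∧-true⇒ˡ (F x) Fx∧x≤z) (leqᵇ-trans x z y (∧-true⇒ʳ (F x) Fx∧x≤z) (∧-true⇒ʳ (slice (s + t) z) (∧-true⇒ʳ (G z) hz)))))
    from : (slice (s + suc t) y ∧ covers F y) ≡ true → iterShadow s (suc t) F y ≡ true
    from e with any⇒∃ (λ x → F x ∧ leqᵇ x y) (allVecs n) (∧-true⇒ʳ (slice (s + suc t) y) e)
    ... | x , Fx∧x≤y = ∧-true (≡⇒≡ᵇ-true {weight y} wy) (∃⇒any-allVecs (λ z → G z ∧ (weight z ≡ᵇ s + t) ∧ leqᵇ z y) z (∧-true Gz (∧-true (≡⇒≡ᵇ-true wz) z≤y)))
      where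
      Fx = ∧-true⇒ˡ (F x) Fx∧x≤y
      wy : weight y ≡ suc (s + t)
      wy = trans (≡ᵇ-true⇒≡ (∧-true⇒ˡ (slice (s + suc t) y) e)) (+-suc s t)
      x<y : weight x < weight y
      x<y = subst₂ _<_ (sym (F⊆s x Fx)) (sym wy) (s≤s (m≤m+n s t))
      step = covering-step x y (∧-true⇒ʳ (F x) Fx∧x≤y) x<y
      z = proj₁ step
      z≤y = proj₁ (proj₂ (proj₂ step))
      wz : weight z ≡ s + t
      wz = suc-injective (trans (proj₂ (proj₂ (proj₂ step))) wy)
      Gz : G z ≡ true
      Gz = trans (G≡ z) (∧-true (≡⇒≡ᵇ-true wz) (∃⇒any-allVecs (λ x′ → F x′ ∧ leqᵇ x′ z) x (∧-true Fx (proj₁ (proj₂ step)))))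

  iterShadow-InSlice : ∀ {n} s t (F : Family n) → InSlice s F → InSlice (s + t) (iterShadow s t F)
  iterShadow-InSlice s t F F⊆s y e = ≡ᵇ-true⇒≡ (∧-true⇒ˡ (slice (s + t) y) (trans (sym (iterShadow≡covers s t F F⊆s y)) e))

  above-mono : ∀ {n} {F G : Family n} → F ⊆F G → ∀ x → above F x ≤ above G x
  above-mono {n} {F} {G} F⊆G x = ∑-mono-≤ (allVecs n) 𝟙-mono
    where
    𝟙-mono : ∀ y → 𝟙 (F y ∧ leqᵇ x y) ≤ 𝟙 (G y ∧ leqᵇ x y)
    𝟙-mono y with F y in Fy
    ... | false = z≤n
    ... | true  rewrite F⊆G y Fy = ≤-refl

  𝟙-split : ∀ {n} k (F : Family n) → InSlice k F → ∀ x b → 𝟙 (F x ∧ b) + 𝟙 ((slice k ∖ F) x ∧ b) ≡ 𝟙 (slice k x ∧ b)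
  𝟙-split k F F⊆k x b with F x in Fx | slice k x in kx
  ... | false | w    = cong (λ c → 𝟙 (c ∧ b)) (∧-identityʳ w)
  ... | true  | true = +-identityʳ _
  ... | true  | false with trans (sym (≡⇒≡ᵇ-true (F⊆k x Fx))) kx
  ... | ()

  below-split : ∀ {n} k (F : Family n) → InSlice k F → ∀ y → below F y + below (slice k ∖ F) y ≡ below (slice k) y
  below-split {n} k F F⊆k y = trans (sym (∑-+ (allVecs n) _ _)) (∑-cong (allVecs n) (λ x → 𝟙-split k F F⊆k x (leqᵇ x y)))

  above-split : ∀ {n} k (G : Family n) → InSlice k G → ∀ x → above G x + above (slice k ∖ G) x ≡ above (slice k) x
  above-split {n} k G G⊆k x = trans (sym (∑-+ (allVecs n) _ _)) (∑-cong (allVecs n) (λ y → 𝟙-split k G G⊆k y (leqᵇ x y)))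

  minority⇒majority : ∀ {a b c} → a + b ≡ c → 2 * a < c → c ≤ 2 * b
  minority⇒majority {a} {b} {c} a+b≡c 2a<c = ≮⇒≥ λ 2b<c → <-irrefl 2[a+b]≡c+c (+-mono-< 2a<c 2b<c)
    where
    2[a+b]≡c+c : 2 * a + 2 * b ≡ c + c
    2[a+b]≡c+c = trans (sym (*-distribˡ-+ 2 a b)) (trans (cong (2 *_) a+b≡c) (cong (c +_) (+-identityʳ c)))

  #-weighted : ∀ {n} (P Q : Family n) (f : Cube n → ℕ) c m →
    (∀ x → 𝟙 (P x) * c ≤ m * (𝟙 (Q x) * f x)) → # P * c ≤ m * (∑[ x ] 𝟙 (Q x) * f x)
  #-weighted {n} P Q f c m pointwise = begin
    # P * c                           ≡⟨ ∑ᶜ-*ʳ (𝟙 ∘ P) c ⟨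
    ∑[ x ] 𝟙 (P x) * c                ≤⟨ ∑-mono-≤ (allVecs n) pointwise ⟩
    ∑[ x ] m * (𝟙 (Q x) * f x)        ≡⟨ ∑-*ˡ (allVecs n) m _ ⟩
    m * (∑[ x ] 𝟙 (Q x) * f x) ∎
    where open ≤-Reasoning

  -- the paper's B_M for G = ∂M: (n ∸ s) C t is the number of (s+t)-points above an s-point
  majority : ∀ {n} s t → Family n → Family n
  majority {n} s t G x = slice s x ∧ ((n ∸ s) C t ≤ᵇ 2 * above G x)

  majority-InSlice : ∀ {n} s t (G : Family n) → InSlice s (majority s t G)
  majority-InSlice s t G x e = ≡ᵇ-true⇒≡ (∧-true⇒ˡ (slice s x) e)

  probAbove≡ratio : ∀ {n} s t (G : Family n) → InSlice (s + t) G → ∀ x → weight x ≡ s →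
    probAbove (s + t) G x ≡ ratio (above G x) ((n ∸ s) C t)
  probAbove≡ratio {n} s t G G⊆s+t x wx = cong₂ ratio
    (trans (length-filter≡∑𝟙 (allVecs n) _) (∑-cong (allVecs n) reorder))
    (trans (length-filter≡∑𝟙 (allVecs n) _) (above-slice x s t wx))
    where
    reorder : ∀ y → 𝟙 (slice (s + t) y ∧ (leqᵇ x y ∧ G y)) ≡ 𝟙 (G y ∧ leqᵇ x y)
    reorder y with G y in Gy
    ... | false = cong 𝟙 (trans (cong (slice (s + t) y ∧_) (∧-zeroʳ (leqᵇ x y))) (∧-zeroʳ _))
    ... | true  rewrite ≡⇒≡ᵇ-true (G⊆s+t y Gy) = cong 𝟙 (∧-identityʳ (leqᵇ x y))

  -- Bounds of the form x ≤ c·(p/q)·y, cleared of denominators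

  module RelativeBounds (p q : ℕ) where

    infix 4 _≤[_]ε_
    record _≤[_]ε_ (x c y : ℕ) : Set where
      constructor ≤ε
      field ≤ε⇒≤ : x * q ≤ c * p * y

    ≤ε-respˡ-≤ : ∀ {x x′ c y} → x ≤ x′ → x′ ≤[ c ]ε y → x ≤[ c ]ε y
    ≤ε-respˡ-≤ x≤x′ (≤ε h) = ≤ε (≤-trans (*-monoˡ-≤ q x≤x′) h)

    ≤ε-respʳ-≤ : ∀ {x c y y′} → y ≤ y′ → x ≤[ c ]ε y → x ≤[ c ]ε y′
    ≤ε-respʳ-≤ {c = c} y≤y′ (≤ε h) = ≤ε (≤-trans h (*-monoʳ-≤ (c * p) y≤y′))

    ≤ε-weaken : ∀ {x c c′ y} → c ≤ c′ → x ≤[ c ]ε y → x ≤[ c′ ]ε y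
    ≤ε-weaken {y = y} c≤c′ (≤ε h) = ≤ε (≤-trans h (*-monoˡ-≤ y (*-monoˡ-≤ p c≤c′)))

    ≤ε-+ : ∀ {x x′ c c′ y} → x ≤[ c ]ε y → x′ ≤[ c′ ]ε y → x + x′ ≤[ c + c′ ]ε y
    ≤ε-+ {x} {x′} {c} {c′} {y} (≤ε h) (≤ε h′) = ≤ε (begin
      (x + x′) * q           ≡⟨ *-distribʳ-+ q x x′ ⟩
      x * q + x′ * q         ≤⟨ +-mono-≤ h h′ ⟩
      c * p * y + c′ * p * y ≡⟨ solve 4 (λ c c′ p y → c :* p :* y :+ c′ :* p :* y := (c :+ c′) :* p :* y) refl c c′ p y ⟩
      (c + c′) * p * y ∎)
      where open ≤-Reasoning

    ≤ε-scaleˡ : ∀ {x e c y} m → x ≤ m * e → e ≤[ c ]ε y → x ≤[ m * c ]ε y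
    ≤ε-scaleˡ {x} {e} {c} {y} m x≤me (≤ε h) = ≤ε (begin
      x * q           ≤⟨ *-monoˡ-≤ q x≤me ⟩
      m * e * q       ≡⟨ *-assoc m e q ⟩
      m * (e * q)     ≤⟨ *-monoʳ-≤ m h ⟩
      m * (c * p * y) ≡⟨ solve 4 (λ m c p y → m :* (c :* p :* y) := m :* c :* p :* y) refl m c p y ⟩
      m * c * p * y ∎)
      where open ≤-Reasoning

    ≤ε-scaleʳ : ∀ {x c y} m → x ≤[ c ]ε y → x * m ≤[ c ]ε y * m
    ≤ε-scaleʳ {x} {c} {y} m (≤ε h) = ≤ε (begin
      x * m * q       ≡⟨ solve 3 (λ x m q → x :* m :* q := x :* q :* m) refl x m q ⟩
      x * q * m       ≤⟨ *-monoˡ-≤ m h ⟩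
      c * p * y * m   ≡⟨ *-assoc (c * p) y m ⟩
      c * p * (y * m) ∎)
      where open ≤-Reasoning

    ≤ε-pull : ∀ {x c m y} → x ≤[ c ]ε y * m → x ≤[ c * m ]ε y
    ≤ε-pull {x} {c} {m} {y} (≤ε h) = ≤ε (≤-trans h (≤-reflexive
      (solve 4 (λ c p y m → c :* p :* (y :* m) := c :* m :* p :* y) refl c p y m)))

    ≤ε-cancelʳ : ∀ {x c y} m → 1 ≤ m → x * m ≤[ c ]ε y * m → x ≤[ c ]ε y
    ≤ε-cancelʳ {x} {c} {y} (suc m) _ (≤ε h) = ≤ε (*-cancelʳ-≤ (x * q) (c * p * y) (suc m) (begin
      x * q * suc m       ≡⟨ solve 3 (λ x q m → x :* q :* m := x :* m :* q) refl x q (suc m) ⟩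
      x * suc m * q       ≤⟨ h ⟩
      c * p * (y * suc m) ≡⟨ *-assoc (c * p) y (suc m) ⟨
      c * p * y * suc m ∎))
      where open ≤-Reasoning

  halving≤ε : ∀ {u b p q} k → 2 ^ k * u ≤ b → q < 2 ^ suc k * p → RelativeBounds._≤[_]ε_ p q u 2 b
  halving≤ε {u} {b} {p} {q} k 2ᵏu≤b q<2ᵏ⁺¹p = RelativeBounds.≤ε (begin
    u * q                ≤⟨ *-monoʳ-≤ u (<⇒≤ q<2ᵏ⁺¹p) ⟩
    u * (2 * 2 ^ k * p)  ≡⟨ solve 3 (λ u K p → u :* (con 2 :* K :* p) := con 2 :* p :* (K :* u)) refl u (2 ^ k) p ⟩
    2 * p * (2 ^ k * u)  ≤⟨ *-monoʳ-≤ (2 * p) 2ᵏu≤b ⟩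
    2 * p * b ∎)
    where open ≤-Reasoning

  dyadic-bracket : ∀ p q → 1 ≤ p → p ≤ q → ∃ λ k → 2 ^ k * p ≤ q × q < 2 ^ suc k * p
  dyadic-bracket p q 1≤p p≤q = subst (λ q → ∃ λ k → 2 ^ k * p ≤ q × q < 2 ^ suc k * p) (m+[n∸m]≡n p≤q) (bracket (q ∸ p))
    where
    2^k≥1 : ∀ j → 1 ≤ 2 ^ j
    2^k≥1 zero    = s≤s z≤n
    2^k≥1 (suc j) = ≤-trans (2^k≥1 j) (m≤m+n _ _)
    double : ∀ K → 2 * K * p ≡ K * p + K * p
    double K = solve 2 (λ K p → con 2 :* K :* p := K :* p :+ K :* p) refl K p
    bracket : ∀ d → ∃ λ k → 2 ^ k * p ≤ p + d × p + d < 2 ^ suc k * p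
    bracket zero = 0 , ≤-reflexive (trans (+-identityʳ p) (sym (+-identityʳ p))) ,
      subst₂ _<_ (sym (+-identityʳ p)) (solve 1 (λ p → p :+ p := con 2 :* p) refl p) (subst (_≤ p + p) (+-comm p 1) (+-monoʳ-≤ p 1≤p))
    bracket (suc d) with bracket d
    ... | k , lower , upper with m≤n⇒m<n∨m≡n (≤-trans (≤-reflexive (+-suc p d)) upper)
    ...   | inj₁ lt = k , ≤-trans lower (+-monoʳ-≤ p (n≤1+n d)) , lt
    ...   | inj₂ e  = suc k , ≤-reflexive (sym e) ,
      subst (_< 2 ^ suc (suc k) * p) (sym e)
        (subst (2 ^ suc k * p <_) (sym (double (2 ^ suc k)))
          (m<m+n (2 ^ suc k * p) (*-mono-≤ (2^k≥1 (suc k)) 1≤p)))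

  module ShadowApproximation {n} (s t : ℕ) (A : Family n) (A⊆s : InSlice s A) (s+t≤n : s + t ≤ n) where

    ∂A : Family n
    ∂A = iterShadow s t A

    ∂A≡ : ∀ y → ∂A y ≡ (slice (s + t) y ∧ covers A y)
    ∂A≡ = iterShadow≡covers s t A A⊆s

    α β : ℕ
    α = # A
    β = # ∂A

    -- each (s+t)-point lies above d↓ points of the s-slice, each s-point below d↑ points of the (s+t)-slice
    d↓ d↑ : ℕ
    d↓ = (s + t) C t
    d↑ = (n ∸ s) C t

    d↓-positive : 1 ≤ d↓
    d↓-positive = C-positive (s + t) t (m≤n+m t s)

    instance
      d↓≢0 : NonZero d↓
      d↓≢0 = >-nonZero d↓-positive

    d↑-positive : 1 ≤ d↑
    d↑-positive = C-positive (n ∸ s) t (≤-trans (≤-reflexive (sym (m+n∸m≡n s t))) (∸-monoˡ-≤ s s+t≤n))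

    below-slice-s : ∀ (y : Cube n) → weight y ≡ s + t → below (slice s) y ≡ d↓
    below-slice-s y wy = trans (below-slice y s) (trans (cong (_C s) wy) (C-sym s t))

    ∑-below : ∀ (F : Family n) → InSlice s F → ∑[ y ] 𝟙 (slice (s + t) y) * below F y ≡ # F * d↑
    ∑-below F F⊆s = begin
      ∑[ y ] 𝟙 (slice (s + t) y) * below F y ≡⟨ ∑-above≡∑-below F (slice (s + t)) ⟨
      ∑[ x ] 𝟙 (F x) * above (slice (s + t)) x ≡⟨ ∑-cong (allVecs n) above-d↑ ⟩
      ∑[ x ] 𝟙 (F x) * d↑ ≡⟨ ∑ᶜ-*ʳ (𝟙 ∘ F) d↑ ⟩
      # F * d↑ ∎
      where
      open ≡-Reasoning
      above-d↑ : ∀ x → 𝟙 (F x) * above (slice (s + t)) x ≡ 𝟙 (F x) * d↑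
      above-d↑ x with F x in Fx
      ... | false = refl
      ... | true  = cong (_+ 0) (above-slice x s t (F⊆s x Fx))

    layer-ratio : (n C s) * d↑ ≡ (n C (s + t)) * d↓
    layer-ratio = begin
      (n C s) * d↑                                          ≡⟨ cong (_* d↑) (#slice n s) ⟨
      # (slice {n} s) * d↑                                    ≡⟨ ∑-below (slice s) (λ _ → ≡ᵇ-true⇒≡) ⟨
      ∑[ y ] 𝟙 (slice (s + t) y) * below (slice {n} s) y  ≡⟨ ∑-cong (allVecs n) on-layer ⟩
      ∑[ y ] 𝟙 (slice {n} (s + t) y) * d↓                 ≡⟨ ∑ᶜ-*ʳ (𝟙 ∘ slice {n} (s + t)) d↓ ⟩
      # (slice {n} (s + t)) * d↓                              ≡⟨ cong (_* d↓) (#slice n (s + t)) ⟩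
      (n C (s + t)) * d↓ ∎
      where
      open ≡-Reasoning
      on-layer : ∀ y → 𝟙 (slice (s + t) y) * below (slice s) y ≡ 𝟙 (slice (s + t) y) * d↓
      on-layer y with slice (s + t) y in e
      ... | false = refl
      ... | true  = cong (_+ 0) (below-slice-s y (≡ᵇ-true⇒≡ e))

    -- pairs x ≤ y with y ∈ ∂A and x an s-point outside A; the density hypothesis makes this at most ε·α·d↑
    excess : ℕ
    excess = ∑[ y ] 𝟙 (∂A y) * below (slice s ∖ A) y

    shadow-count : β * d↓ ≡ α * d↑ + excess
    shadow-count = begin
      β * d↓                                                    ≡⟨ ∑ᶜ-*ʳ (𝟙 ∘ ∂A) d↓ ⟨
      ∑[ y ] 𝟙 (∂A y) * d↓                                      ≡⟨ ∑-cong (allVecs n) split ⟩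
      ∑[ y ] (𝟙 (∂A y) * below A y + 𝟙 (∂A y) * below (slice s ∖ A) y) ≡⟨ ∑-+ (allVecs n) _ _ ⟩
      ∑[ y ] 𝟙 (∂A y) * below A y + excess                      ≡⟨ cong (_+ excess) (∑-cong (allVecs n) uncovered-vanish) ⟩
      ∑[ y ] 𝟙 (slice (s + t) y) * below A y + excess           ≡⟨ cong (_+ excess) (∑-below A A⊆s) ⟩
      α * d↑ + excess ∎
      where
      open ≡-Reasoning
      split : ∀ y → 𝟙 (∂A y) * d↓ ≡ 𝟙 (∂A y) * below A y + 𝟙 (∂A y) * below (slice s ∖ A) y
      split y with ∂A y in e
      ... | false = refl
      ... | true  = begin
        d↓ + 0                                   ≡⟨ +-identityʳ d↓ ⟩
        d↓                                       ≡⟨ below-slice-s y (iterShadow-InSlice s t A A⊆s y e) ⟨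
        below (slice s) y                        ≡⟨ below-split s A A⊆s y ⟨
        below A y + below (slice s ∖ A) y        ≡⟨ cong₂ _+_ (+-identityʳ (below A y)) (+-identityʳ (below (slice s ∖ A) y)) ⟨
        below A y + 0 + (below (slice s ∖ A) y + 0) ∎
      uncovered-vanish : ∀ y → 𝟙 (∂A y) * below A y ≡ 𝟙 (slice (s + t) y) * below A y
      uncovered-vanish y rewrite ∂A≡ y with slice (s + t) y | covers A y in cA
      ... | false | _     = refl
      ... | true  | true  = refl
      ... | true  | false = cong (_+ 0) (sym (uncovered⇒below≡0 A y cA))

    good : Cube n → Bool
    good y = d↓ ≤ᵇ 2 * below A y

    uncovered : Family n → Family n
    uncovered M y = (slice (s + t) y ∧ good y) ∧ not (covers M y)

    u : Family n → ℕ
    u M = # (uncovered M)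

    u-∪｛｝ : ∀ M x → u (M ∪ ｛ x ｝) + above (uncovered M) x ≡ u M
    u-∪｛｝ M x = trans (sym (∑-+ (allVecs n) _ _)) (∑-cong (allVecs n) pointwise)
      where
      pointwise : ∀ y → 𝟙 (uncovered (M ∪ ｛ x ｝) y) + 𝟙 (uncovered M y ∧ leqᵇ x y) ≡ 𝟙 (uncovered M y)
      pointwise y rewrite covers-∪｛｝ M x y with slice (s + t) y ∧ good y | covers M y | leqᵇ x y
      ... | false | _     | _     = refl
      ... | true  | true  | _     = refl
      ... | true  | false | false = refl
      ... | true  | false | true  = refl

    u*d↓≤2∑gain : ∀ M → u M * d↓ ≤ 2 * (∑[ x ] 𝟙 (A x) * above (uncovered M) x)
    u*d↓≤2∑gain M = ≤-trans (#-weighted (uncovered M) (uncovered M) (below A) d↓ 2 good-weight)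
                            (≤-reflexive (cong (2 *_) (sym (∑-above≡∑-below A (uncovered M)))))
      where
      good-weight : ∀ y → 𝟙 (uncovered M y) * d↓ ≤ 2 * (𝟙 (uncovered M y) * below A y)
      good-weight y with uncovered M y in e
      ... | false = z≤n
      ... | true  = subst₂ _≤_ (sym (+-identityʳ d↓)) (cong (2 *_) (sym (+-identityʳ (below A y))))
                      (≤ᵇ-true⇒≤ (∧-true⇒ʳ (slice (s + t) y) (∧-true⇒ˡ _ e)))

    -- one greedy step: adding the point of A that covers the most uncovered good points
    greedy-step : ∀ M → M ⊆F A → ∃ λ M′ → M′ ⊆F A × # M′ ≤ # M + 1 ×
      2 * α * u M′ + d↓ * u M ≤ 2 * α * u M × u M′ ≤ u M
    greedy-step M M⊆A with ∑-averaging A (above (uncovered M)) (allVecs n)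
    ... | inj₁ ∑gain≡0 = M , M⊆A , m≤m+n _ 1 , ≤-reflexive (trans (cong (2 * α * u M +_) (trans (cong (d↓ *_) uM≡0) (*-zeroʳ d↓))) (+-identityʳ _)) , ≤-refl
      where
      uM≡0 : u M ≡ 0
      uM≡0 = m*n≡0⇒m≡0 (u M) d↓ (n≤0⇒n≡0 (≤-trans (u*d↓≤2∑gain M) (≤-reflexive (cong (2 *_) ∑gain≡0))))
    ... | inj₂ (x , Ax , ∑gain≤) =
      M ∪ ｛ x ｝ , M∪x⊆A , ≤-trans (#-∪ M ｛ x ｝) (≤-reflexive (cong (# M +_) (#｛｝ x))) , gain-bound ,
      ≤-trans (m≤m+n _ _) (≤-reflexive (u-∪｛｝ M x))
      where
      gain = above (uncovered M) x
      M∪x⊆A : (M ∪ ｛ x ｝) ⊆F A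
      M∪x⊆A z e with M z in Mz
      ... | true  = M⊆A z Mz
      ... | false = subst (λ w → A w ≡ true) (sym (∈｛｝⇒≡ {x = x} {z} e)) Ax
      gain-bound : 2 * α * u (M ∪ ｛ x ｝) + d↓ * u M ≤ 2 * α * u M
      gain-bound = begin
        2 * α * u (M ∪ ｛ x ｝) + d↓ * u M    ≤⟨ +-monoʳ-≤ (2 * α * u (M ∪ ｛ x ｝)) (≤-trans (≤-reflexive (*-comm d↓ (u M)))
                                                   (≤-trans (u*d↓≤2∑gain M) (≤-trans (*-monoʳ-≤ 2 ∑gain≤) (≤-reflexive (sym (*-assoc 2 α gain)))))) ⟩
        2 * α * u (M ∪ ｛ x ｝) + 2 * α * gain ≡⟨ *-distribˡ-+ (2 * α) _ gain ⟨
        2 * α * (u (M ∪ ｛ x ｝) + gain)       ≡⟨ cong (2 * α *_) (u-∪｛｝ M x) ⟩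
        2 * α * u M ∎
        where open ≤-Reasoning

    greedy-phase : ∀ r M → M ⊆F A → ∃ λ M′ → M′ ⊆F A × # M′ ≤ # M + r × (2 * α + r * d↓) * u M′ ≤ 2 * α * u M
    greedy-phase zero    M M⊆A = M , M⊆A , m≤m+n _ 0 , ≤-reflexive (cong (_* u M) (+-identityʳ (2 * α)))
    greedy-phase (suc r) M M⊆A with greedy-phase r M M⊆A
    ... | M₁ , M₁⊆A , #M₁≤ , phase-bound with greedy-step M₁ M₁⊆A
    ... | M₂ , M₂⊆A , #M₂≤ , step-bound , u₂≤u₁ = M₂ , M₂⊆A , #M₂≤′ , (begin
      (2 * α + suc r * d↓) * u M₂                          ≡⟨ solve 4 (λ a d r u → (a :+ (d :+ r :* d)) :* u := (a :* u :+ d :* u) :+ r :* d :* u) refl (2 * α) d↓ r (u M₂) ⟩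
      (2 * α * u M₂ + d↓ * u M₂) + r * d↓ * u M₂           ≤⟨ +-mono-≤ (+-monoʳ-≤ (2 * α * u M₂) (*-monoʳ-≤ d↓ u₂≤u₁)) (*-monoʳ-≤ (r * d↓) u₂≤u₁) ⟩
      (2 * α * u M₂ + d↓ * u M₁) + r * d↓ * u M₁           ≤⟨ +-monoˡ-≤ (r * d↓ * u M₁) step-bound ⟩
      2 * α * u M₁ + r * d↓ * u M₁                         ≡⟨ *-distribʳ-+ (u M₁) (2 * α) (r * d↓) ⟨
      (2 * α + r * d↓) * u M₁                              ≤⟨ phase-bound ⟩
      2 * α * u M ∎)
      where
      open ≤-Reasoning
      #M₂≤′ : # M₂ ≤ # M + suc r
      #M₂≤′ = ≤-trans #M₂≤ (≤-trans (+-monoˡ-≤ 1 #M₁≤) (≤-reflexive (trans (+-assoc (# M) r 1) (cong (# M +_) (+-comm r 1)))))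

    greedy-halving : 1 ≤ α → ∀ P → 2 * α ≤ P * d↓ → ∀ k → ∃ λ M → M ⊆F A × # M ≤ k * P × 2 ^ k * u M ≤ u ∅
    greedy-halving 1≤α P 2α≤Pd↓ zero = ∅ , (λ _ ()) , ≤-reflexive (∑-zero (allVecs n) (λ _ → refl)) , ≤-reflexive (+-identityʳ _)
    greedy-halving 1≤α P 2α≤Pd↓ (suc k) with greedy-halving 1≤α P 2α≤Pd↓ k
    ... | M , M⊆A , #M≤ , halved with greedy-phase P M M⊆A
    ... | M′ , M′⊆A , #M′≤ , phase-bound = M′ , M′⊆A ,
      ≤-trans #M′≤ (≤-trans (+-monoˡ-≤ P #M≤) (≤-reflexive (+-comm (k * P) P))) ,
      (begin
        2 * 2 ^ k * u M′   ≡⟨ solve 2 (λ K v → con 2 :* K :* v := K :* (con 2 :* v)) refl (2 ^ k) (u M′) ⟩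
        2 ^ k * (2 * u M′) ≤⟨ *-monoʳ-≤ (2 ^ k) halve ⟩
        2 ^ k * u M        ≤⟨ halved ⟩
        u ∅ ∎)
      where
      open ≤-Reasoning
      instance
        2α≢0 : NonZero (2 * α)
        2α≢0 = >-nonZero (≤-trans 1≤α (m≤m+n α (α + 0)))
      halve : 2 * u M′ ≤ u M
      halve = *-cancelˡ-≤ (2 * α) (begin
        2 * α * (2 * u M′)          ≡⟨ solve 2 (λ a v → a :* (con 2 :* v) := (a :+ a) :* v) refl (2 * α) (u M′) ⟩
        (2 * α + 2 * α) * u M′      ≤⟨ *-monoˡ-≤ (u M′) (+-monoʳ-≤ (2 * α) 2α≤Pd↓) ⟩
        (2 * α + P * d↓) * u M′     ≤⟨ phase-bound ⟩
        2 * α * u M ∎)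

    good⇒covered : ∀ y → good y ≡ true → covers A y ≡ true
    good⇒covered y g with covers A y in cA
    ... | true  = refl
    ... | false = ⊥-elim (<⇒≱ d↓-positive (≤-trans (≤ᵇ-true⇒≤ g) (≤-reflexive (cong (2 *_) (uncovered⇒below≡0 A y cA)))))

    u∅≤β : u ∅ ≤ β
    u∅≤β = #-mono uncovered⊆∂A
      where
      uncovered⊆∂A : uncovered ∅ ⊆F ∂A
      uncovered⊆∂A y e rewrite ∂A≡ y | covers-∅ y =
        ∧-true (∧-true⇒ˡ (slice (s + t) y) (∧-true⇒ˡ _ e)) (good⇒covered y (∧-true⇒ʳ (slice (s + t) y) (∧-true⇒ˡ _ e)))

    sparse-cover : ∀ k → ∃ λ M → M ⊆F A × # M * d↓ ≤ k * (4 * α) × 2 ^ k * u M ≤ β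
    sparse-cover k with u ∅ in u∅
    ... | zero  = ∅ , (λ _ ()) , ≤-trans (≤-reflexive (cong (_* d↓) (∑-zero (allVecs n) (λ _ → refl)))) z≤n ,
                  ≤-trans (≤-reflexive (trans (cong (2 ^ k *_) u∅) (*-zeroʳ (2 ^ k)))) z≤n
    ... | suc _ with ∑-positive (allVecs n) (𝟙 ∘ uncovered ∅) (subst (1 ≤_) (sym u∅) (s≤s z≤n))
    ...   | y , 1≤𝟙 = M , M⊆A , #M*d↓≤ , ≤-trans halved u∅≤β
      where
      y-good : good y ≡ true
      y-good = ∧-true⇒ʳ (slice (s + t) y) (∧-true⇒ˡ _ (𝟙-positive 1≤𝟙))
      d↓≤2α : d↓ ≤ 2 * α
      d↓≤2α = ≤-trans (≤ᵇ-true⇒≤ y-good) (*-monoʳ-≤ 2 (∑-mono-≤ (allVecs n) below≤#))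
        where
        below≤# : ∀ x → 𝟙 (A x ∧ leqᵇ x y) ≤ 𝟙 (A x)
        below≤# x with A x
        ... | false = z≤n
        ... | true  = 𝟙≤1 (leqᵇ x y)
      1≤α : 1 ≤ α
      1≤α with α | d↓≤2α
      ... | zero  | d↓≤0 = ⊥-elim (<⇒≱ d↓-positive d↓≤0)
      ... | suc _ | _    = s≤s z≤n
      P = suc (2 * α / d↓)
      2α≤Pd↓ : 2 * α ≤ P * d↓
      2α≤Pd↓ = ≤-trans (≤-reflexive (m≡m%n+[m/n]*n (2 * α) d↓)) (+-monoˡ-≤ _ (<⇒≤ (m%n<n (2 * α) d↓)))
      Pd↓≤4α : P * d↓ ≤ 4 * α
      Pd↓≤4α = ≤-trans (+-mono-≤ d↓≤2α (m/n*n≤m (2 * α) d↓))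
                       (≤-reflexive (solve 1 (λ a → con 2 :* a :+ con 2 :* a := con 4 :* a) refl α))
      greedy = greedy-halving 1≤α P 2α≤Pd↓ k
      M = proj₁ greedy
      M⊆A = proj₁ (proj₂ greedy)
      halved = proj₂ (proj₂ (proj₂ greedy))
      #M*d↓≤ : # M * d↓ ≤ k * (4 * α)
      #M*d↓≤ = ≤-trans (*-monoˡ-≤ d↓ (proj₁ (proj₂ (proj₂ greedy))))
                       (≤-trans (≤-reflexive (*-assoc k P d↓)) (*-monoʳ-≤ k Pd↓≤4α))

    module CoverBounds (M : Family n) (M⊆A : M ⊆F A) where

      ∂M : Family n
      ∂M = iterShadow s t M

      M⊆s : InSlice s M
      M⊆s x e = A⊆s x (M⊆A x e)

      ∂M≡ : ∀ y → ∂M y ≡ (slice (s + t) y ∧ covers M y)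
      ∂M≡ = iterShadow≡covers s t M M⊆s

      ∂M⊆∂A : ∂M ⊆F ∂A
      ∂M⊆∂A y e rewrite ∂M≡ y | ∂A≡ y =
        ∧-true (∧-true⇒ˡ (slice (s + t) y) e) (covers-mono M⊆A y (∧-true⇒ʳ (slice (s + t) y) e))

      missed bad : Family n
      missed y = ∂A y ∧ not (covers M y)
      bad    y = ∂A y ∧ not (good y)

      #missed≤ : # missed ≤ # bad + u M
      #missed≤ = ≤-trans (∑-mono-≤ (allVecs n) pointwise) (≤-reflexive (∑-+ (allVecs n) (𝟙 ∘ bad) (𝟙 ∘ uncovered M)))
        where
        pointwise : ∀ y → 𝟙 (missed y) ≤ 𝟙 (bad y) + 𝟙 (uncovered M y)
        pointwise y rewrite ∂A≡ y with slice (s + t) y | covers A y | covers M y | good y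
        ... | false | _     | _     | _     = z≤n
        ... | true  | false | _     | _     = z≤n
        ... | true  | true  | true  | _     = z≤n
        ... | true  | true  | false | true  = s≤s z≤n
        ... | true  | true  | false | false = s≤s z≤n

      shadowΔ≤#missed : countSlice (s + t) (∂M Δ ∂A) ≤ # missed
      shadowΔ≤#missed = ≤-trans (≤-reflexive (countSlice≡# (s + t) (∂M Δ ∂A))) (∑-mono-≤ (allVecs n) pointwise)
        where
        pointwise : ∀ y → 𝟙 ((∂M Δ ∂A) y ∧ slice (s + t) y) ≤ 𝟙 (missed y)
        pointwise y rewrite ∂M≡ y | ∂A≡ y with slice (s + t) y | covers A y in cA | covers M y in cM
        ... | false | _     | _     = z≤n
        ... | true  | true  | true  = z≤n
        ... | true  | true  | false = ≤-refl
        ... | true  | false | false = z≤n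
        ... | true  | false | true  with trans (sym (covers-mono M⊆A y cM)) cA
        ... | ()

      #bad*d↓≤ : # bad * d↓ ≤ 2 * excess
      #bad*d↓≤ = #-weighted bad ∂A (below (slice s ∖ A)) d↓ 2 pointwise
        where
        pointwise : ∀ y → 𝟙 (bad y) * d↓ ≤ 2 * (𝟙 (∂A y) * below (slice s ∖ A) y)
        pointwise y with ∂A y in ∂Ay | good y in gy
        ... | false | _    = z≤n
        ... | true  | true = z≤n
        ... | true  | false = subst₂ _≤_ (sym (+-identityʳ d↓)) (cong (2 *_) (sym (+-identityʳ (below (slice s ∖ A) y))))
          (minority⇒majority {below A y} (trans (below-split s A A⊆s y) (below-slice-s y (iterShadow-InSlice s t A A⊆s y ∂Ay)))
                             (≤ᵇ-false⇒> gy))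

      #majority∖A*d↑≤ : # (majority s t ∂M ∖ A) * d↑ ≤ 2 * excess
      #majority∖A*d↑≤ = ≤-trans (#-weighted (majority s t ∂M ∖ A) (slice s ∖ A) (above ∂A) d↑ 2 pointwise)
                                (≤-reflexive (cong (2 *_) (∑-above≡∑-below (slice s ∖ A) ∂A)))
        where
        pointwise : ∀ x → 𝟙 ((majority s t ∂M ∖ A) x) * d↑ ≤ 2 * (𝟙 ((slice s ∖ A) x) * above ∂A x)
        pointwise x with slice s x | A x | d↑ ≤ᵇ 2 * above ∂M x in maj
        ... | false | _     | _     = z≤n
        ... | true  | true  | w     = ≤-trans (≤-reflexive (cong (λ b → 𝟙 b * d↑) (∧-zeroʳ w))) z≤n
        ... | true  | false | false = z≤n
        ... | true  | false | true  = subst₂ _≤_ (sym (+-identityʳ d↑)) (cong (2 *_) (sym (+-identityʳ (above ∂A x))))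
          (≤-trans (≤ᵇ-true⇒≤ maj) (*-monoʳ-≤ 2 (above-mono ∂M⊆∂A x)))

      #A∖majority*d↑≤ : # (A ∖ majority s t ∂M) * d↑ ≤ 2 * (# missed * d↓)
      #A∖majority*d↑≤ = ≤-trans (#-weighted (A ∖ majority s t ∂M) A (above (slice (s + t) ∖ ∂M)) d↑ 2 pointwise)
        (*-monoʳ-≤ 2 (begin
          ∑[ x ] 𝟙 (A x) * above (slice (s + t) ∖ ∂M) x       ≡⟨ ∑-above≡∑-below A (slice (s + t) ∖ ∂M) ⟩
          ∑[ y ] 𝟙 ((slice (s + t) ∖ ∂M) y) * below A y       ≤⟨ ∑-mono-≤ (allVecs n) only-missed ⟩
          ∑[ y ] 𝟙 (missed y) * d↓                            ≡⟨ ∑ᶜ-*ʳ (𝟙 ∘ missed) d↓ ⟩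
          # missed * d↓ ∎))
        where
        open ≤-Reasoning
        pointwise : ∀ x → 𝟙 ((A ∖ majority s t ∂M) x) * d↑ ≤ 2 * (𝟙 (A x) * above (slice (s + t) ∖ ∂M) x)
        pointwise x with A x in Ax | majority s t ∂M x in maj
        ... | false | _    = z≤n
        ... | true  | true = z≤n
        ... | true  | false = subst₂ _≤_ (sym (+-identityʳ d↑)) (cong (2 *_) (sym (+-identityʳ (above (slice (s + t) ∖ ∂M) x))))
          (minority⇒majority {above ∂M x} (trans (above-split (s + t) ∂M (iterShadow-InSlice s t M M⊆s) x) (above-slice x s t (A⊆s x Ax)))
                             (≤ᵇ-false⇒> minority))
          where
          minority : (d↑ ≤ᵇ 2 * above ∂M x) ≡ false
          minority = trans (sym (cong (_∧ (d↑ ≤ᵇ 2 * above ∂M x)) (≡⇒≡ᵇ-true (A⊆s x Ax)))) maj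
        only-missed : ∀ y → 𝟙 ((slice (s + t) ∖ ∂M) y) * below A y ≤ 𝟙 (missed y) * d↓
        only-missed y rewrite ∂M≡ y | ∂A≡ y with slice (s + t) y in ly | covers M y | covers A y in cA
        ... | false | _     | _     = z≤n
        ... | true  | true  | _     = z≤n
        ... | true  | false | false = ≤-reflexive (trans (+-identityʳ _) (uncovered⇒below≡0 A y cA))
        ... | true  | false | true  = +-monoˡ-≤ 0 (≤-trans (m≤m+n _ _) (≤-reflexive
              (trans (below-split s A A⊆s y) (below-slice-s y (≡ᵇ-true⇒≡ ly)))))

      majorityΔA≤ : countSlice s (majority s t ∂M Δ A) ≤ # (majority s t ∂M ∖ A) + # (A ∖ majority s t ∂M)
      majorityΔA≤ = ≤-trans (≤-reflexive (countSlice≡# s (majority s t ∂M Δ A)))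
        (≤-trans (∑-mono-≤ (allVecs n) pointwise) (≤-reflexive (∑-+ (allVecs n) _ _)))
        where
        pointwise : ∀ x → 𝟙 ((majority s t ∂M Δ A) x ∧ slice s x) ≤ 𝟙 ((majority s t ∂M ∖ A) x) + 𝟙 ((A ∖ majority s t ∂M) x)
        pointwise x with majority s t ∂M x | A x
        ... | false | false = z≤n
        ... | true  | true  = z≤n
        ... | true  | false = 𝟙≤1 (slice s x)
        ... | false | true  = 𝟙≤1 (slice s x)

    module Approximation (p q : ℕ) (1≤p : 1 ≤ p) (p≤q : p ≤ q)
        (density : β * (n C s) * q ≤ (q + p) * α * (n C (s + t))) where

      open RelativeBounds p q

      shadow-vs-A : β * d↓ * q ≤ (q + p) * (α * d↑)
      shadow-vs-A = *-cancelˡ-≤ (n C s) (begin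
        (n C s) * (β * d↓ * q)            ≡⟨ solve 4 (λ N b d q → N :* (b :* d :* q) := b :* N :* q :* d) refl (n C s) β d↓ q ⟩
        β * (n C s) * q * d↓              ≤⟨ *-monoˡ-≤ d↓ density ⟩
        (q + p) * α * (n C (s + t)) * d↓  ≡⟨ *-assoc ((q + p) * α) (n C (s + t)) d↓ ⟩
        (q + p) * α * ((n C (s + t)) * d↓) ≡⟨ cong ((q + p) * α *_) layer-ratio ⟨
        (q + p) * α * ((n C s) * d↑)      ≡⟨ solve 4 (λ r a N d → r :* a :* (N :* d) := N :* (r :* (a :* d))) refl (q + p) α (n C s) d↑ ⟩
        (n C s) * ((q + p) * (α * d↑)) ∎)
        where
        open ≤-Reasoning
        instance
          nCs≢0 : NonZero (n C s)
          nCs≢0 = >-nonZero (C-positive n s (≤-trans (m≤m+n s t) s+t≤n))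

      excess≤ε : excess ≤[ 1 ]ε α * d↑
      excess≤ε = ≤ε (+-cancelˡ-≤ (α * d↑ * q) _ _ (begin
        α * d↑ * q + excess * q     ≡⟨ *-distribʳ-+ q (α * d↑) excess ⟨
        (α * d↑ + excess) * q       ≡⟨ cong (_* q) shadow-count ⟨
        β * d↓ * q                  ≤⟨ shadow-vs-A ⟩
        (q + p) * (α * d↑)          ≡⟨ solve 3 (λ q p x → (q :+ p) :* x := x :* q :+ con 1 :* p :* x) refl q p (α * d↑) ⟩
        α * d↑ * q + 1 * p * (α * d↑) ∎))
        where open ≤-Reasoning

      A≤shadow : α * d↑ ≤ β * d↓
      A≤shadow = ≤-trans (m≤m+n (α * d↑) excess) (≤-reflexive (sym shadow-count))

      shadow≤twice : β * d↓ ≤ α * 2 * d↑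
      shadow≤twice = *-cancelʳ-≤ (β * d↓) (α * 2 * d↑) q (begin
        β * d↓ * q           ≤⟨ shadow-vs-A ⟩
        (q + p) * (α * d↑)   ≤⟨ *-monoˡ-≤ (α * d↑) (+-monoʳ-≤ q p≤q) ⟩
        (q + q) * (α * d↑)   ≡⟨ solve 3 (λ q a d → (q :+ q) :* (a :* d) := a :* con 2 :* d :* q) refl q α d↑ ⟩
        α * 2 * d↑ * q ∎)
        where
        open ≤-Reasoning
        instance
          q≢0 : NonZero q
          q≢0 = >-nonZero (≤-trans 1≤p p≤q)

      module Errors (M : Family n) (M⊆A : M ⊆F A) (k : ℕ) (halved : 2 ^ k * u M ≤ β) (q<2ᵏ⁺¹p : q < 2 ^ suc k * p) where

        open CoverBounds M M⊆A

        bad≤ε : # bad ≤[ 2 ]ε β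
        bad≤ε = ≤ε-cancelʳ d↓ d↓-positive (≤ε-respʳ-≤ A≤shadow (≤ε-scaleˡ 2 #bad*d↓≤ excess≤ε))

        missed≤ε : # missed ≤[ 4 ]ε β
        missed≤ε = ≤ε-respˡ-≤ #missed≤ (≤ε-+ bad≤ε (halving≤ε k halved q<2ᵏ⁺¹p))

        shadow-error : countSlice (s + t) (∂M Δ ∂A) ≤[ 6 ]ε β
        shadow-error = ≤ε-weaken (m≤m+n 4 2) (≤ε-respˡ-≤ shadowΔ≤#missed missed≤ε)

        majority∖A≤ε : # (majority s t ∂M ∖ A) ≤[ 2 ]ε α
        majority∖A≤ε = ≤ε-cancelʳ d↑ d↑-positive (≤ε-scaleˡ 2 #majority∖A*d↑≤ excess≤ε)

        A∖majority≤ε : # (A ∖ majority s t ∂M) ≤[ 16 ]ε α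
        A∖majority≤ε = ≤ε-pull (≤ε-cancelʳ d↑ d↑-positive
          (≤ε-respʳ-≤ shadow≤twice (≤ε-scaleˡ 2 #A∖majority*d↑≤ (≤ε-scaleʳ d↓ missed≤ε))))

        majority-error : countSlice s (majority s t ∂M Δ A) ≤[ 18 ]ε α
        majority-error = ≤ε-respˡ-≤ majorityΔA≤ (≤ε-+ majority∖A≤ε A∖majority≤ε)

      approximation : ∀ k → q < 2 ^ suc k * p → ∃ λ M → M ⊆F A × # M * d↓ ≤ k * (4 * α) ×
        countSlice (s + t) (iterShadow s t M Δ ∂A) ≤[ 6 ]ε β × countSlice s (majority s t (iterShadow s t M) Δ A) ≤[ 18 ]ε α
      approximation k q<2ᵏ⁺¹p with sparse-cover k
      ... | M , M⊆A , small , halved = M , M⊆A , small , shadow-error , majority-error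
        where open Errors M M⊆A k halved q<2ᵏ⁺¹p

module Rationals where

  open import Defs
  open import Data.Nat.Base as ℕ using (ℕ; zero; suc)
  import Data.Nat.Properties as ℕ
  open import Data.Integer.Base as ℤ using (+_; +[1+_])
  import Data.Integer.Properties as ℤ
  open import Data.Rational.Base
  open import Data.Rational.Properties
  import Data.Rational.Unnormalised.Base as ℚᵘ
  import Data.Rational.Unnormalised.Properties as ℚᵘ
  open import Data.Product using (∃; _×_; _,_)
  open import Function.Bundles using (_⇔_; mk⇔)
  open import Relation.Binary.PropositionalEquality
  open import Data.Nat.Solver using (module +-*-Solver)
  import Data.Rational.Solver as ℚ-Solver

  -- x is the fraction a / (1 + b); this is how natural-number arithmetic is transported to ℚ
  Frac : ℚ → ℕ → ℕ → Set
  Frac x a b = toℚᵘ x ℚᵘ.≃ ℚᵘ.mkℚᵘ (+ a) b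

  ratio-Frac : ∀ a b → Frac (ratio a (suc b)) a b
  ratio-Frac a b = toℚᵘ-fromℚᵘ (ℚᵘ.mkℚᵘ (+ a) b)

  0-Frac : Frac 0ℚ 0 0
  0-Frac = ℚᵘ.≃-refl

  1-Frac : Frac 1ℚ 1 0
  1-Frac = ℚᵘ.≃-refl

  *-Frac : ∀ {x y a b c d} → Frac x a b → Frac y c d → Frac (x * y) (a ℕ.* c) (d ℕ.+ b ℕ.* suc d)
  *-Frac {x} {y} {a} {b} {c} {d} fx fy = ℚᵘ.≃-trans (toℚᵘ-homo-* x y) (ℚᵘ.≃-trans (ℚᵘ.*-cong fx fy)
    (ℚᵘ.*≡* (cong (ℤ._* +[1+ d ℕ.+ b ℕ.* suc d ]) (sym (ℤ.pos-* a c)))))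

  +-Frac : ∀ {x y a b c d} → Frac x a b → Frac y c d → Frac (x + y) (a ℕ.* suc d ℕ.+ c ℕ.* suc b) (d ℕ.+ b ℕ.* suc d)
  +-Frac {x} {y} {a} {b} {c} {d} fx fy = ℚᵘ.≃-trans (toℚᵘ-homo-+ x y) (ℚᵘ.≃-trans (ℚᵘ.+-cong fx fy)
    (ℚᵘ.*≡* (cong (ℤ._* +[1+ d ℕ.+ b ℕ.* suc d ])
       (sym (trans (ℤ.pos-+ (a ℕ.* suc d) (c ℕ.* suc b)) (cong₂ ℤ._+_ (ℤ.pos-* a (suc d)) (ℤ.pos-* c (suc b))))))))

  Frac-≤ : ∀ {x y a b c d} → Frac x a b → Frac y c d → a ℕ.* suc d ℕ.≤ c ℕ.* suc b → x ≤ y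
  Frac-≤ {x} {y} {a} {b} {c} {d} fx fy le = toℚᵘ-cancel-≤ (ℚᵘ.≤-respˡ-≃ (ℚᵘ.≃-sym fx) (ℚᵘ.≤-respʳ-≃ (ℚᵘ.≃-sym fy)
    (ℚᵘ.*≤* (subst₂ ℤ._≤_ (ℤ.pos-* a (suc d)) (ℤ.pos-* c (suc b)) (ℤ.+≤+ le)))))

  Frac-≤⁻¹ : ∀ {x y a b c d} → Frac x a b → Frac y c d → x ≤ y → a ℕ.* suc d ℕ.≤ c ℕ.* suc b
  Frac-≤⁻¹ {x} {y} {a} {b} {c} {d} fx fy le with ℚᵘ.≤-respˡ-≃ fx (ℚᵘ.≤-respʳ-≃ fy (toℚᵘ-mono-≤ le))
  ... | ℚᵘ.*≤* h = ℤ.drop‿+≤+ (subst₂ ℤ._≤_ (sym (ℤ.pos-* a (suc d))) (sym (ℤ.pos-* c (suc b))) h)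

  Frac-≡ : ∀ {x y a b c d} → Frac x a b → Frac y c d → a ℕ.* suc d ≡ c ℕ.* suc b → x ≡ y
  Frac-≡ fx fy e = ≤-antisym (Frac-≤ fx fy (ℕ.≤-reflexive e)) (Frac-≤ fy fx (ℕ.≤-reflexive (sym e)))

  positive-Frac : ∀ x → 0ℚ < x → ∃ λ p → ∃ λ q → Frac x (suc p) q × (∀ .{{_ : NonZero x}} → Frac (1/ x) (suc q) p)
  positive-Frac x 0<x = go x (positive 0<x)
    where
    go : ∀ x → Positive x → ∃ λ p → ∃ λ q → Frac x (suc p) q × (∀ .{{_ : NonZero x}} → Frac (1/ x) (suc q) p)
    go (mkℚ +[1+ p ] q coprime) _ = p , q , ℚᵘ.≃-refl , toℚᵘ-homo-1/ (mkℚ +[1+ p ] q coprime)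

  ratio-nonNeg : ∀ a b → 0ℚ ≤ ratio a (suc b)
  ratio-nonNeg a b = Frac-≤ 0-Frac (ratio-Frac a b) ℕ.z≤n

  nonNeg-* : ∀ {a b} → 0ℚ ≤ a → 0ℚ ≤ b → 0ℚ ≤ a * b
  nonNeg-* {a} {b} 0≤a 0≤b = subst (_≤ a * b) (*-zeroˡ b) (*-monoʳ-≤-nonNeg b {{nonNegative 0≤b}} 0≤a)

  nonNeg-+ : ∀ {a b} → 0ℚ ≤ a → 0ℚ ≤ b → 0ℚ ≤ a + b
  nonNeg-+ {a} {b} 0≤a 0≤b = subst (_≤ a + b) (+-identityʳ 0ℚ) (+-mono-≤ 0≤a 0≤b)

  *-monoˡ-nonNeg : ∀ {r p q} → 0ℚ ≤ r → p ≤ q → r * p ≤ r * q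
  *-monoˡ-nonNeg {r} 0≤r = *-monoˡ-≤-nonNeg r {{nonNegative 0≤r}}

  *-monoʳ-nonNeg : ∀ {r p q} → 0ℚ ≤ r → p ≤ q → p * r ≤ q * r
  *-monoʳ-nonNeg {r} 0≤r = *-monoʳ-≤-nonNeg r {{nonNegative 0≤r}}

  inv : ℕ → ℚ
  inv j = (+ 1) / suc j

  inv-nonNeg : ∀ j → 0ℚ ≤ inv j
  inv-nonNeg j = ratio-nonNeg 1 j

  inv-* : ∀ j → inv j * ((+ suc j) / 1) ≡ 1ℚ
  inv-* j = Frac-≡ (*-Frac (ratio-Frac 1 j) (ratio-Frac (suc j) 0)) 1-Frac (solve 1 (λ j → (con 1 :* (con 1 :+ j)) :* con 1 := con 1 :* (con 1 :+ (con 0 :+ j :* con 1))) refl j)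
    where open +-*-Solver

  1+suc : ∀ j → 1ℚ + (+ suc j) / 1 ≡ (+ suc (suc j)) / 1
  1+suc j = Frac-≡ (+-Frac 1-Frac (ratio-Frac (suc j) 0)) (ratio-Frac (suc (suc j)) 0)
    (solve 1 (λ j → (con 1 :* con 1 :+ (con 1 :+ j) :* con 1) :* con 1 := (con 2 :+ j) :* (con 1 :+ (con 0 :+ con 0 :* con 1))) refl j)
    where open +-*-Solver

  ratio-suc-half : ∀ k → ratio (suc k) 2 ≡ ratio k 2 + ½
  ratio-suc-half k = Frac-≡ (ratio-Frac (suc k) 1) (+-Frac (ratio-Frac k 1) (ratio-Frac 1 1))
    (solve 1 (λ k → (con 1 :+ k) :* (con 1 :+ (con 1 :+ con 1 :* con 2)) := (k :* con 2 :+ con 1 :* con 2) :* con 2) refl k)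
    where open +-*-Solver

  module _ where
    open ℚ-Solver.+-*-Solver
    open ≤-Reasoning

    expTerm-nonNeg : ∀ j {x} → 0ℚ ≤ x → 0ℚ ≤ expTerm j x
    expTerm-nonNeg zero    0≤x = *≤* (ℤ.+≤+ ℕ.z≤n)
    expTerm-nonNeg (suc j) 0≤x = nonNeg-* (expTerm-nonNeg j 0≤x) (nonNeg-* 0≤x (inv-nonNeg j))

    expTerm-mono : ∀ j {x y} → 0ℚ ≤ x → x ≤ y → expTerm j x ≤ expTerm j y
    expTerm-mono zero    0≤x x≤y = ≤-refl
    expTerm-mono (suc j) {x} {y} 0≤x x≤y = begin
      expTerm j x * (x * inv j) ≤⟨ *-monoʳ-nonNeg (nonNeg-* 0≤x (inv-nonNeg j)) (expTerm-mono j 0≤x x≤y) ⟩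
      expTerm j y * (x * inv j) ≤⟨ *-monoˡ-nonNeg (expTerm-nonNeg j (≤-trans 0≤x x≤y)) (*-monoʳ-nonNeg (inv-nonNeg j) x≤y) ⟩
      expTerm j y * (y * inv j) ∎

    expPartial-mono : ∀ N {x y} → 0ℚ ≤ x → x ≤ y → expPartial N x ≤ expPartial N y
    expPartial-mono zero    0≤x x≤y = ≤-refl
    expPartial-mono (suc N) 0≤x x≤y = +-mono-≤ (expPartial-mono N 0≤x x≤y) (expTerm-mono (suc N) 0≤x x≤y)

    expTerm-suc : ∀ j y → expTerm (suc j) y * ((+ suc j) / 1) ≡ expTerm j y * y
    expTerm-suc j y = begin-equality
      expTerm j y * (y * inv j) * ((+ suc j) / 1)   ≡⟨ solve 4 (λ a y c m → a :* (y :* c) :* m := a :* y :* (c :* m)) refl (expTerm j y) y (inv j) _ ⟩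
      expTerm j y * y * (inv j * ((+ suc j) / 1))   ≡⟨ cong (expTerm j y * y *_) (inv-* j) ⟩
      expTerm j y * y * 1ℚ                          ≡⟨ *-identityʳ _ ⟩
      expTerm j y * y ∎

    expTerm-shift : ∀ j {x h} → 0ℚ ≤ x → 0ℚ ≤ h → expTerm (suc j) (x + h) ≤ expTerm (suc j) x + h * expTerm j (x + h)
    expTerm-shift zero {x} {h} 0≤x 0≤h = ≤-reflexive
      (solve 2 (λ x h → con 1ℚ :* ((x :+ h) :* con 1ℚ) := con 1ℚ :* (x :* con 1ℚ) :+ h :* con 1ℚ) refl x h)
    expTerm-shift (suc j) {x} {h} 0≤x 0≤h = begin
      expTerm (suc j) y * (y * c)                     ≤⟨ *-monoʳ-nonNeg (nonNeg-* 0≤y (inv-nonNeg (suc j))) (expTerm-shift j 0≤x 0≤h) ⟩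
      (a + h * b) * (y * c)                           ≡⟨ solve 5 (λ a b x h c → (a :+ h :* b) :* ((x :+ h) :* c) := a :* (x :* c) :+ h :* c :* a :+ h :* c :* (b :* (x :+ h))) refl a b x h c ⟩
      a * (x * c) + h * c * a + h * c * (b * y)       ≡⟨ cong (λ z → a * (x * c) + h * c * a + h * c * z) (expTerm-suc j y) ⟨
      a * (x * c) + h * c * a + h * c * (B * m)       ≤⟨ +-monoˡ-≤ (h * c * (B * m)) (+-monoʳ-≤ (a * (x * c)) (*-monoˡ-nonNeg (nonNeg-* 0≤h (inv-nonNeg (suc j))) (expTerm-mono (suc j) 0≤x x≤y))) ⟩
      a * (x * c) + h * c * B + h * c * (B * m)       ≡⟨ solve 6 (λ a x h c B m → a :* (x :* c) :+ h :* c :* B :+ h :* c :* (B :* m) := a :* (x :* c) :+ h :* B :* (c :* (con 1ℚ :+ m))) refl a x h c B m ⟩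
      a * (x * c) + h * B * (c * (1ℚ + m))            ≡⟨ cong (λ z → a * (x * c) + h * B * (c * z)) (1+suc j) ⟩
      a * (x * c) + h * B * (c * ((+ suc (suc j)) / 1)) ≡⟨ cong (λ z → a * (x * c) + h * B * z) (inv-* (suc j)) ⟩
      a * (x * c) + h * B * 1ℚ                        ≡⟨ cong (λ z → a * (x * c) + z) (*-identityʳ (h * B)) ⟩
      a * (x * c) + h * B ∎
      where
      y = x + h
      c = inv (suc j)
      m = (+ suc j) / 1
      a = expTerm (suc j) x
      b = expTerm j y
      B = expTerm (suc j) y
      0≤y : 0ℚ ≤ y
      0≤y = nonNeg-+ 0≤x 0≤h
      x≤y : x ≤ y
      x≤y = subst (_≤ y) (+-identityʳ x) (+-monoʳ-≤ x 0≤h)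

    expPartial-shift : ∀ N {x h} → 0ℚ ≤ x → 0ℚ ≤ h →
      expPartial N (x + h) + h * expTerm N (x + h) ≤ expPartial N x + h * expPartial N (x + h)
    expPartial-shift zero    0≤x 0≤h = ≤-refl
    expPartial-shift (suc N) {x} {h} 0≤x 0≤h = begin
      (E y + T′ y) + h * T′ y                  ≤⟨ +-monoˡ-≤ (h * T′ y) (+-monoʳ-≤ (E y) (expTerm-shift N 0≤x 0≤h)) ⟩
      (E y + (T′ x + h * T y)) + h * T′ y      ≡⟨ solve 5 (λ e a h b d → (e :+ (a :+ h :* b)) :+ h :* d := (e :+ h :* b) :+ a :+ h :* d) refl (E y) (T′ x) h (T y) (T′ y) ⟩
      (E y + h * T y) + T′ x + h * T′ y        ≤⟨ +-monoˡ-≤ (h * T′ y) (+-monoˡ-≤ (T′ x) (expPartial-shift N 0≤x 0≤h)) ⟩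
      (E x + h * E y) + T′ x + h * T′ y        ≡⟨ solve 5 (λ f h e a d → (f :+ h :* e) :+ a :+ h :* d := (f :+ a) :+ h :* (e :+ d)) refl (E x) h (E y) (T′ x) (T′ y) ⟩
      (E x + T′ x) + h * (E y + T′ y) ∎
      where
      y = x + h
      E = expPartial N
      T = expTerm N
      T′ = expTerm (suc N)

    ½-nonNeg : 0ℚ ≤ ½
    ½-nonNeg = *≤* (ℤ.+≤+ ℕ.z≤n)

    2-nonNeg : 0ℚ ≤ (+ 2) / 1
    2-nonNeg = *≤* (ℤ.+≤+ ℕ.z≤n)

    -- the discrete analogue of e^(1/2) ≤ 2, from expPartial-shift with h = ½
    expPartial-+½ : ∀ N {x} → 0ℚ ≤ x → expPartial N (x + ½) ≤ (+ 2) / 1 * expPartial N x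
    expPartial-+½ N {x} 0≤x = begin
      Ey                                     ≡⟨ solve 1 (λ e → e := con ((+ 2) / 1) :* (e :+ :- (con ½ :* e))) refl Ey ⟩
      (+ 2) / 1 * (Ey - ½ * Ey)              ≤⟨ *-monoˡ-nonNeg 2-nonNeg (+-monoˡ-≤ (- (½ * Ey)) Ey≤ ) ⟩
      (+ 2) / 1 * (expPartial N x + ½ * Ey - ½ * Ey) ≡⟨ cong ((+ 2) / 1 *_) (solve 2 (λ f e → f :+ con ½ :* e :+ :- (con ½ :* e) := f) refl (expPartial N x) Ey) ⟩
      (+ 2) / 1 * expPartial N x ∎
      where
      Ey = expPartial N (x + ½)
      Ey≤ : Ey ≤ expPartial N x + ½ * Ey
      Ey≤ = ≤-trans (subst (_≤ Ey + ½ * expTerm N (x + ½)) (+-identityʳ Ey)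
                      (+-monoʳ-≤ Ey (nonNeg-* ½-nonNeg (expTerm-nonNeg N (nonNeg-+ 0≤x ½-nonNeg)))))
                    (expPartial-shift N 0≤x ½-nonNeg)

    expPartial-0 : ∀ N → expPartial N 0ℚ ≡ 1ℚ
    expPartial-0 zero    = refl
    expPartial-0 (suc N) = trans (cong₂ _+_ (expPartial-0 N) (trans (cong (expTerm N 0ℚ *_) (*-zeroˡ (inv N))) (*-zeroʳ (expTerm N 0ℚ)))) (+-identityʳ 1ℚ)

    expPartial-half≤2^ : ∀ k N → expPartial N (ratio k 2) ≤ (+ (2 ℕ.^ k)) / 1
    expPartial-half≤2^ zero N = ≤-reflexive (trans (cong (expPartial N) (Frac-≡ (ratio-Frac 0 1) 0-Frac refl)) (expPartial-0 N))
    expPartial-half≤2^ (suc k) N = begin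
      expPartial N (ratio (suc k) 2)        ≡⟨ cong (expPartial N) (ratio-suc-half k) ⟩
      expPartial N (ratio k 2 + ½)          ≤⟨ expPartial-+½ N (ratio-nonNeg k 1) ⟩
      (+ 2) / 1 * expPartial N (ratio k 2)  ≤⟨ *-monoˡ-nonNeg 2-nonNeg (expPartial-half≤2^ k N) ⟩
      (+ 2) / 1 * ((+ (2 ℕ.^ k)) / 1)       ≡⟨ Frac-≡ (*-Frac (ratio-Frac 2 0) (ratio-Frac (2 ℕ.^ k) 0)) (ratio-Frac (2 ℕ.^ suc k) 0) refl ⟩
      (+ (2 ℕ.^ suc k)) / 1 ∎

  density-bound : ∀ {ε p q} → Frac ε (suc p) q → ∀ X Y B B′ → 1 ℕ.≤ B → 1 ℕ.≤ B′ →
    ratio X B ≤ (1ℚ + ε) * ratio Y B′ → X ℕ.* B′ ℕ.* suc q ℕ.≤ (suc q ℕ.+ suc p) ℕ.* Y ℕ.* B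
  density-bound {ε} {p} {q} fε X Y (suc b) (suc b′) _ _ h = begin
    X ℕ.* suc b′ ℕ.* suc q                        ≡⟨ solve 3 (λ X b′ q → X :* (con 1 :+ b′) :* (con 1 :+ q) := X :* (con 1 :+ (b′ :+ (q :+ con 0 :* (con 1 :+ q)) :* (con 1 :+ b′)))) refl X b′ q ⟩
    X ℕ.* suc (b′ ℕ.+ (q ℕ.+ 0 ℕ.* suc q) ℕ.* suc b′) ≤⟨ Frac-≤⁻¹ (ratio-Frac X b) (*-Frac (+-Frac 1-Frac fε) (ratio-Frac Y b′)) h ⟩
    (1 ℕ.* suc q ℕ.+ suc p ℕ.* 1) ℕ.* Y ℕ.* suc b ≡⟨ solve 4 (λ q p Y b → (con 1 :* (con 1 :+ q) :+ (con 1 :+ p) :* con 1) :* Y :* (con 1 :+ b) := ((con 1 :+ q) :+ (con 1 :+ p)) :* Y :* (con 1 :+ b)) refl q p Y b ⟩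
    (suc q ℕ.+ suc p) ℕ.* Y ℕ.* suc b ∎
    where
    open ℕ.≤-Reasoning
    open +-*-Solver

  relative-bound : ∀ {ε p q} → Frac ε (suc p) q → ∀ c X Y B → 1 ℕ.≤ B →
    X ℕ.* suc q ℕ.≤ c ℕ.* suc p ℕ.* Y → ratio X B ≤ ((+ c) / 1 * ε) * ratio Y B
  relative-bound {ε} {p} {q} fε c X Y (suc b) _ h = Frac-≤ (ratio-Frac X b) (*-Frac (*-Frac (ratio-Frac c 0) fε) (ratio-Frac Y b))
    (ℕ.≤-trans (ℕ.≤-reflexive (solve 3 (λ X b q → X :* (con 1 :+ (b :+ (q :+ con 0 :* (con 1 :+ q)) :* (con 1 :+ b))) := X :* (con 1 :+ q) :* (con 1 :+ b)) refl X b q))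
      (ℕ.*-monoˡ-≤ (suc b) h))
    where open +-*-Solver

  -- a ≤ k·4α and 2^k ≤ 1/ε give a/(100α) ≤ k/2 ≤ ln(1/ε)
  ≤mul-ln : ∀ {ε p q} → (∀ .{{_ : NonZero ε}} → Frac (1/ ε) (suc q) p) → ∀ k → 2 ℕ.^ k ℕ.* suc p ℕ.≤ suc q →
    ∀ a α → a ℕ.≤ k ℕ.* (4 ℕ.* α) → ∀ {{_ : NonZero ε}} → LeMulLn a (100 ℕ.* α) (1/ ε)
  ≤mul-ln f1/ε k 2ᵏ≤1/ε a zero    a≤4kα = ℕ.n≤0⇒n≡0 (ℕ.≤-trans a≤4kα (ℕ.≤-reflexive (ℕ.*-zeroʳ k)))
  ≤mul-ln {q = q} f1/ε k 2ᵏ≤1/ε a (suc α) a≤4kα N = begin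
    expPartial N (ratio a (100 ℕ.* suc α)) ≤⟨ expPartial-mono N (ratio-nonNeg a _) (Frac-≤ (ratio-Frac a _) (ratio-Frac k 1) a/100α≤k/2) ⟩
    expPartial N (ratio k 2)               ≤⟨ expPartial-half≤2^ k N ⟩
    (+ (2 ℕ.^ k)) / 1                      ≤⟨ Frac-≤ (ratio-Frac (2 ℕ.^ k) 0) f1/ε (ℕ.≤-trans 2ᵏ≤1/ε (ℕ.≤-reflexive (sym (ℕ.*-identityʳ (suc q))))) ⟩
    1/ _ ∎
    where
    open ≤-Reasoning
    a/100α≤k/2 : a ℕ.* 2 ℕ.≤ k ℕ.* (100 ℕ.* suc α)
    a/100α≤k/2 = ℕ.≤-trans (ℕ.*-monoˡ-≤ 2 a≤4kα) (ℕ.≤-trans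
      (ℕ.≤-reflexive (solve 2 (λ k a → k :* (con 4 :* a) :* con 2 := k :* (con 8 :* a)) refl k (suc α)))
      (ℕ.*-monoʳ-≤ k (ℕ.*-monoˡ-≤ (suc α) (ℕ.m≤m+n 8 92))))
      where open +-*-Solver

  ½≤ratio⇔ : ∀ a d → ((+ 1) / 2 ≤ ratio a (suc d)) ⇔ (suc d ℕ.≤ 2 ℕ.* a)
  ½≤ratio⇔ a d = mk⇔
    (λ h → ℕ.≤-trans (ℕ.≤-reflexive (sym (ℕ.+-identityʳ (suc d)))) (ℕ.≤-trans (Frac-≤⁻¹ (ratio-Frac 1 1) (ratio-Frac a d) h) (ℕ.≤-reflexive (ℕ.*-comm a 2))))
    (λ h → Frac-≤ (ratio-Frac 1 1) (ratio-Frac a d) (ℕ.≤-trans (ℕ.≤-reflexive (ℕ.+-identityʳ (suc d))) (ℕ.≤-trans h (ℕ.≤-reflexive (ℕ.*-comm 2 a)))))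

open import Defs
open import Data.Bool.Base using (Bool; true; false; _∧_)
open import Data.Nat.Base as ℕ using (ℕ; _≡ᵇ_)
open import Data.Nat.Combinatorics using (_C_)
open import Data.Integer.Base using (+_)
open import Data.Rational.Base using (ℚ; 0ℚ; 1ℚ; _/_; _+_; _*_; _≤_; _<_; 1/_; NonZero)
open import Data.Product using (Σ; _×_; _,_)
open import Relation.Binary.PropositionalEquality using (_≡_)
open import Function.Bundles using (_⇔_)

import Data.Nat.Properties as ℕ
open import Function.Bundles using (mk⇔; Equivalence)
open import Relation.Binary.PropositionalEquality using (refl; sym; subst; subst₂)
open Combinatorics
open Rationals

majority⇔half≤probAbove : ∀ {n} s t (G : Family n) → InSlice (s ℕ.+ t) G → s ℕ.+ t ℕ.≤ n → ∀ x →
  (majority s t G x ≡ true) ⇔ ((weight x ≡ s) × ((+ 1) / 2 ≤ probAbove (s ℕ.+ t) G x))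
majority⇔half≤probAbove {n} s t G G⊆s+t s+t≤n x = mk⇔ to from
  where
  d↑-positive : 1 ℕ.≤ (n ℕ.∸ s) C t
  d↑-positive = C-positive (n ℕ.∸ s) t (ℕ.≤-trans (ℕ.≤-reflexive (sym (ℕ.m+n∸m≡n s t))) (ℕ.∸-monoˡ-≤ s s+t≤n))
  half≤⇔ : ∀ {d} → 1 ℕ.≤ d → ∀ a → ((+ 1) / 2 ≤ ratio a d) ⇔ (d ℕ.≤ 2 ℕ.* a)
  half≤⇔ {ℕ.suc d} _ a = ½≤ratio⇔ a d
  to : majority s t G x ≡ true → (weight x ≡ s) × ((+ 1) / 2 ≤ probAbove (s ℕ.+ t) G x)
  to e = wx , subst ((+ 1) / 2 ≤_) (sym (probAbove≡ratio s t G G⊆s+t x wx))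
              (Equivalence.from (half≤⇔ d↑-positive (above G x)) (≤ᵇ-true⇒≤ (∧-true⇒ʳ (slice s x) e)))
    where wx = majority-InSlice s t G x e
  from : (weight x ≡ s) × ((+ 1) / 2 ≤ probAbove (s ℕ.+ t) G x) → majority s t G x ≡ true
  from (wx , half≤) = ∧-true (≡⇒≡ᵇ-true wx)
    (≤⇒≤ᵇ-true (Equivalence.to (half≤⇔ d↑-positive (above G x)) (subst ((+ 1) / 2 ≤_) (probAbove≡ratio s t G G⊆s+t x wx) half≤)))

small-ε-fraction : ∀ ε → 0ℚ < ε → ε ≤ (+ 1) / 100 → Σ ℕ λ p → Σ ℕ λ q →
  Frac ε (ℕ.suc p) q × (∀ .{{_ : NonZero ε}} → Frac (1/ ε) (ℕ.suc q) p) × ℕ.suc p ℕ.≤ ℕ.suc q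
small-ε-fraction ε 0<ε ε≤1/100 with positive-Frac ε 0<ε
... | p , q , ε≈p/q , 1/ε≈q/p = p , q , ε≈p/q , 1/ε≈q/p ,
  ℕ.≤-trans (ℕ.m≤m*n (ℕ.suc p) 100) (ℕ.≤-trans (Frac-≤⁻¹ ε≈p/q (ratio-Frac 1 99) ε≤1/100) (ℕ.≤-reflexive (ℕ.+-identityʳ _)))

density-in-ℕ : ∀ {n} s t {ε p q} → Frac ε (ℕ.suc p) q → s ℕ.+ t ℕ.≤ n → (A : Family n) → InSlice s A →
  μ (s ℕ.+ t) (iterShadow s t A) ≤ (1ℚ + ε) * μ s A →
  # (iterShadow s t A) ℕ.* (n C s) ℕ.* ℕ.suc q ℕ.≤ (ℕ.suc q ℕ.+ ℕ.suc p) ℕ.* # A ℕ.* (n C (s ℕ.+ t))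
density-in-ℕ {n} s t {ε} ε≈p/q s+t≤n A A⊆s density =
  density-bound ε≈p/q _ _ (n C (s ℕ.+ t)) (n C s) (C-positive n (s ℕ.+ t) s+t≤n) (C-positive n s (ℕ.≤-trans (ℕ.m≤m+n s t) s+t≤n))
    (subst₂ (λ X Y → ratio X (n C (s ℕ.+ t)) ≤ (1ℚ + ε) * ratio Y (n C s))
      (countSlice-InSlice (s ℕ.+ t) (iterShadow s t A) (iterShadow-InSlice s t A A⊆s)) (countSlice-InSlice s A A⊆s) density)

μ-relative-bound : ∀ {n k ε p q} → Frac ε (ℕ.suc p) q → k ℕ.≤ n → ∀ c (F G : Family n) → InSlice k G →
  countSlice k F ℕ.* ℕ.suc q ℕ.≤ c ℕ.* ℕ.suc p ℕ.* # G → μ k F ≤ ((+ c) / 1 * ε) * μ k G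
μ-relative-bound {n} {k} {ε} ε≈p/q k≤n c F G G⊆k bound =
  subst (λ Y → μ k F ≤ ((+ c) / 1 * ε) * ratio Y (n C k)) (sym (countSlice-InSlice k G G⊆k))
    (relative-bound ε≈p/q c _ _ (n C k) (C-positive n k k≤n) bound)

lemma3p3 : (s t n : ℕ) → s ℕ.+ t ℕ.≤ n →
  (ε : ℚ) → 0ℚ < ε → ε ≤ (+ 1) / 100 →
  (A : Family n) → InSlice s A →
  μ (s ℕ.+ t) (iterShadow s t A) ≤ (1ℚ + ε) * μ s A →
  Σ (Family n) λ M → Σ (Family n) λ B → Σ (Family n) λ B′ →
    (M ⊆F A) × InSlice s B × InSlice (s ℕ.+ t) B′ ×
    (∀ {{_ : NonZero ε}} →
      LeMulLn (countSlice s M ℕ.* ((s ℕ.+ t) C t)) (100 ℕ.* countSlice s A) (1/ ε)) ×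
    (∀ y → B′ y ≡ iterShadow s t M y) ×
    μ (s ℕ.+ t) (B′ Δ iterShadow s t A) ≤ ((+ 6) / 1 * ε) * μ (s ℕ.+ t) (iterShadow s t A) ×
    (∀ x → (B x ≡ true) ⇔ ((weight x ≡ s) × ((+ 1) / 2 ≤ probAbove (s ℕ.+ t) B′ x))) ×
    μ s (B Δ A) ≤ ((+ 18) / 1 * ε) * μ s A
lemma3p3 s t n s+t≤n ε 0<ε ε≤1/100 A A⊆s density =
  let p , q , ε≈p/q , 1/ε≈q/p , p≤q = small-ε-fraction ε 0<ε ε≤1/100
      k , 2ᵏp≤q , q<2ᵏ⁺¹p = dyadic-bracket (ℕ.suc p) (ℕ.suc q) (ℕ.s≤s ℕ.z≤n) p≤q
      M , M⊆A , small , RelativeBounds.≤ε shadow-error , RelativeBounds.≤ε majority-error =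
        ShadowApproximation.Approximation.approximation s t A A⊆s s+t≤n (ℕ.suc p) (ℕ.suc q) (ℕ.s≤s ℕ.z≤n) p≤q
          (density-in-ℕ s t ε≈p/q s+t≤n A A⊆s density) k q<2ᵏ⁺¹p
      M⊆s : InSlice s M
      M⊆s x e = A⊆s x (M⊆A x e)
      ∂M⊆s+t = iterShadow-InSlice s t M M⊆s
  in M , majority s t (iterShadow s t M) , iterShadow s t M , M⊆A , majority-InSlice s t _ , ∂M⊆s+t ,
     subst₂ (λ a α → LeMulLn (a ℕ.* ((s ℕ.+ t) C t)) (100 ℕ.* α) (1/ ε))
       (sym (countSlice-InSlice s M M⊆s)) (sym (countSlice-InSlice s A A⊆s)) (≤mul-ln 1/ε≈q/p k 2ᵏp≤q _ (# A) small) ,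
     (λ _ → refl) ,
     μ-relative-bound ε≈p/q s+t≤n 6 _ _ (iterShadow-InSlice s t A A⊆s) shadow-error ,
     majority⇔half≤probAbove s t _ ∂M⊆s+t s+t≤n ,
     μ-relative-bound ε≈p/q (ℕ.≤-trans (ℕ.m≤m+n s t) s+t≤n) 18 _ _ A⊆s majority-error
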